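{- Let $G$ be a connected graph with $n\ge 2$ vertices and $m$ edges, and let $\mu(G)=m-n+1$ be its cyclomatic number. Then $$\frac{m}{n-1}\,\mu(G)\le C(G)\le \frac{n}{2}\,\mu(G).$$ The first inequality is an equality if and only if $G$ is electrically-edge-equivalent. The second inequality is an equality if and only if $G$ is a tree or $G=K_n$.
   Context: All graphs are finite and simple. For a connected graph $G$, regard each edge as a unit resistor. The resistance distance $\Omega_G(i,j)$ is the effective resistance between vertices $i$ and $j$ in this network. The effective conductance is $\sigma_G(i,j)=1/\Omega_G(i,j)$. The global cyclicity index is $$C(G)=\sum_{ij\in E(G)}\big[\sigma_G(i,j)-1\big]=\sum_{ij\in E(G)}\frac{1}{\Omega_G(i,j)}-|E(G)|.$$ A connected graph $G$ is electrically-edge-equivalent if $\Omega_G(u,v)=\Omega_G(x,y)$ for any two edges $uv,xy\in E(G)$. $K_n$ denotes the complete graph on $n$ vertices. -}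

module Defs where

open import Data.Nat as ℕ using (ℕ; zero; suc; _<ᵇ_)
open import Data.Integer as ℤ using (ℤ; +_; -[1+_])
open import Data.Rational as ℚ using (ℚ; mkℚ; 0ℚ; 1ℚ; _+_; _-_; _*_)
open import Data.Fin using (Fin; toℕ; _≟_)
open import Data.Bool using (Bool; true; false; if_then_else_; _∧_)
open import Data.List using (List; []; _∷_; [_]; length; concatMap; foldr; allFin; map)
open import Data.List.Relation.Unary.Unique.Propositional using (Unique)
open import Data.Product using (_×_; _,_; ∃-syntax)
open import Relation.Binary.PropositionalEquality using (_≡_; _≢_)
open import Relation.Nullary using (¬_; does)

record Graph (n : ℕ) : Set where
  field
    adj    : Fin n → Fin n → Bool
    sym    : ∀ i j → adj i j ≡ adj j i
    irrefl : ∀ i → adj i i ≡ false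
open Graph public

edges : ∀ {n} → Graph n → List (Fin n × Fin n)
edges {n} G = concatMap (λ i → concatMap (λ j →
    if adj G i j ∧ (toℕ i <ᵇ toℕ j) then [ (i , j) ] else []) (allFin n)) (allFin n)

numEdges : ∀ {n} → Graph n → ℕ
numEdges G = length (edges G)

data Reach {n} (G : Graph n) (i : Fin n) : Fin n → Set where
  here : Reach G i i
  step : ∀ {j k} → Reach G i j → adj G j k ≡ true → Reach G i k

Connected : ∀ {n} → Graph n → Set
Connected {n} G = ∀ (i j : Fin n) → Reach G i j

data Path {n} (G : Graph n) : List (Fin n) → Set where
  nil  : Path G []
  one  : ∀ x → Path G [ x ]
  cons : ∀ x y xs → adj G x y ≡ true → Path G (y ∷ xs) → Path G (x ∷ y ∷ xs)

last : ∀ {n} → Fin n → List (Fin n) → Fin n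
last x [] = x
last x (y ∷ ys) = last y ys

IsCycle : ∀ {n} → Graph n → List (Fin n) → Set
IsCycle G [] = Data.Empty.⊥ where import Data.Empty
IsCycle G (x ∷ xs) =
  (2 ℕ.≤ length xs) × Unique (x ∷ xs) × Path G (x ∷ xs) × (adj G (last x xs) x ≡ true)

Acyclic : ∀ {n} → Graph n → Set
Acyclic {n} G = ∀ (c : List (Fin n)) → ¬ IsCycle G c

IsTree : ∀ {n} → Graph n → Set
IsTree G = Connected G × Acyclic G

IsComplete : ∀ {n} → Graph n → Set
IsComplete {n} G = ∀ (i j : Fin n) → i ≢ j → adj G i j ≡ true

sumV : ∀ {n} → (Fin n → ℚ) → ℚ
sumV {n} f = foldr _+_ 0ℚ (map f (allFin n))

δ : ∀ {n} → Fin n → Fin n → ℚ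
δ a k = if does (k ≟ a) then 1ℚ else 0ℚ

-- Electrical model: every edge a unit resistor. v is a vector of node
-- potentials produced by injecting a unit current at i and extracting it at j:
-- by Ohm's law the current on edge kl is v k - v l, and Kirchhoff's current
-- law at every node k says the total current leaving k equals the external
-- current injected at k.
IsPotential : ∀ {n} → Graph n → Fin n → Fin n → (Fin n → ℚ) → Set
IsPotential G i j v = ∀ k →
  sumV (λ l → if adj G k l then v k - v l else 0ℚ) ≡ δ i k - δ j k

IsResistanceDistance : ∀ {n} → Graph n → (Fin n → Fin n → ℚ) → Set
IsResistanceDistance G Ω = ∀ i j → ∃[ v ] (IsPotential G i j v × Ω i j ≡ v i - v j)

-- Total reciprocal (0 at 0); only applied to positive resistances on edges,
-- and to positive n - 1, where it is the ordinary reciprocal.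
inv : ℚ → ℚ
inv p@(mkℚ (+ suc _) _ _) = ℚ.1/ p
inv p@(mkℚ -[1+ _ ] _ _) = ℚ.1/ p
inv (mkℚ (+ zero) _ _) = 0ℚ

fromℕ : ℕ → ℚ
fromℕ k = ℤ.+ k ℚ./ 1

cyclicity : ∀ {n} → Graph n → (Fin n → Fin n → ℚ) → ℚ
cyclicity G Ω = foldr _+_ 0ℚ (map (λ e → inv (Ω (Data.Product.proj₁ e) (Data.Product.proj₂ e))) (edges G))
                - fromℕ (numEdges G)
  where import Data.Product

cyclomatic : ∀ {n} → Graph n → ℚ
cyclomatic {n} G = fromℕ (numEdges G) - fromℕ n + 1ℚ

ElecEdgeEquiv : ∀ {n} → Graph n → (Fin n → Fin n → ℚ) → Set
ElecEdgeEquiv G Ω = ∀ u v x y → adj G u v ≡ true → adj G x y ≡ true → Ω u v ≡ Ω x y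

-- Write x_e = Ω(e) for the edges e. Averaging the unit-current potentials over all sinks gives
-- Foster's theorem Σ_e x_e = n - 1, so the lower bound is the Cauchy–Schwarz inequality
-- (Σ_e x_e)(Σ_e 1/x_e) ≥ m², with equality iff all x_e agree. For the upper bound, the maximum
-- principle for the potential of a unit current through an edge ij shows 2/n ≤ x_ij ≤ 1, hence
-- (1 - x)(n x - 2) ≥ 0, i.e. 1/x - 1 ≤ (n/2)(1 - x); summing over the edges gives C ≤ (n/2) μ.
-- Equality forces x_e ∈ {1, 2/n} for every edge. If all x_e = 1 there is no cycle, since around a
-- cycle current could bypass any of its edges; an edge with x_e = 2/n makes both of its ends adjacent
-- to every vertex, and then every other vertex as well, so G = K_n.

module Submission where

open import Defs hiding (sym)
open import Algebra.Bundles using (CommutativeRing)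
open import Data.Bool using (Bool; true; false; if_then_else_; _∧_; T)
import Data.Bool.Properties as Boolₚ
open import Data.Empty using (⊥-elim)
open import Data.Fin using (Fin; zero; suc; toℕ) renaming (_≟_ to _≟ᶠ_)
import Data.Fin.Properties as Finₚ
open import Data.Integer using (+_; -[1+_])
import Data.Integer.Solver as ℤ-Solver
open import Data.List using (List; []; _∷_; [_]; _++_; map; foldr; allFin; tabulate; concatMap; length)
import Data.List.Properties as Listₚ
open import Data.List.Relation.Unary.All as All using (All; []; _∷_)
open import Data.List.Relation.Unary.AllPairs using ([]; _∷_)
open import Data.List.Relation.Unary.Unique.Propositional using (Unique)
open import Data.Nat as ℕ using (ℕ; zero; suc; _<ᵇ_)
import Data.Nat.Properties as ℕₚ
open import Data.Product using (∃; _×_; _,_; proj₁; proj₂)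
open import Data.Rational using (ℚ; mkℚ; toℚᵘ; 0ℚ; 1ℚ; _+_; _-_; -_; _*_; _/_; _≤_; _<_; positive; nonNegative; nonPositive)
open import Data.Rational.Properties
import Data.Rational.Unnormalised as ℚᵘ
import Data.Rational.Unnormalised.Properties as ℚᵘₚ
open import Data.Sum as Sum using (_⊎_; inj₁; inj₂)
open import Data.Unit using (tt)
open import Function using (id; _∘_)
open import Function.Bundles using (_⇔_; mk⇔; Equivalence)
open import Function.Construct.Composition using (_⇔-∘_)
open import Level using (0ℓ)
open import Relation.Binary.Definitions using (tri<; tri≈; tri>)
open import Relation.Binary.PropositionalEquality hiding ([_])
open import Relation.Nullary using (¬_; yes; no; _×-dec_; ¬?)
open import Relation.Nullary.Decidable using (dec⇒maybe; decidable-stable)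
open import Tactic.RingSolver using (solve-∀)
open import Tactic.RingSolver.Core.AlmostCommutativeRing using (AlmostCommutativeRing; fromCommutativeRing)

open import Algebra.Properties.Group +-0-group using (x∙y⁻¹≈ε⇒x≈y; ⁻¹-involutive)
open import Algebra.Properties.Semiring.Sum (CommutativeRing.semiring +-*-commutativeRing)
  using (sum; sum-cong-≗; ∑-distrib-+; ∑-comm; *-distribˡ-sum; sum-replicate-zero)

-- Rational arithmetic

ℚ-ring : AlmostCommutativeRing 0ℓ 0ℓ
ℚ-ring = fromCommutativeRing +-*-commutativeRing (λ p → dec⇒maybe (0ℚ ≟ p))

2ℚ : ℚ
2ℚ = 1ℚ + 1ℚ

private
  q-p+p≡q : ∀ p q → q - p + p ≡ q
  q-p+p≡q = solve-∀ ℚ-ring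

p≤q⇒0≤q-p : ∀ {p q} → p ≤ q → 0ℚ ≤ q - p
p≤q⇒0≤q-p {p} {q} p≤q = subst (_≤ q - p) (+-inverseʳ p) (+-monoˡ-≤ (- p) p≤q)

0≤q-p⇒p≤q : ∀ {p q} → 0ℚ ≤ q - p → p ≤ q
0≤q-p⇒p≤q {p} {q} 0≤q-p = subst₂ _≤_ (+-identityˡ p) (q-p+p≡q p q) (+-monoˡ-≤ p 0≤q-p)

p<q⇒0<q-p : ∀ {p q} → p < q → 0ℚ < q - p
p<q⇒0<q-p {p} {q} p<q = subst (_< q - p) (+-inverseʳ p) (+-monoˡ-< (- p) p<q)

p<q⇒p-q<0 : ∀ {p q} → p < q → p - q < 0ℚ
p<q⇒p-q<0 {p} {q} p<q = subst (p - q <_) (+-inverseʳ q) (+-monoˡ-< (- q) p<q)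

0<q-p⇒p<q : ∀ {p q} → 0ℚ < q - p → p < q
0<q-p⇒p<q {p} {q} 0<q-p = subst₂ _<_ (+-identityˡ p) (q-p+p≡q p q) (+-monoˡ-< p 0<q-p)

p-q≡0⇒p≡q : ∀ {p q} → p - q ≡ 0ℚ → p ≡ q
p-q≡0⇒p≡q = x∙y⁻¹≈ε⇒x≈y _ _

neg-cancel-≤ : ∀ {p q} → - p ≤ - q → q ≤ p
neg-cancel-≤ {p} {q} -p≤-q = subst₂ _≤_ (⁻¹-involutive q) (⁻¹-involutive p) (neg-antimono-≤ -p≤-q)

p≡q⇒p-q≡0 : ∀ {p q} → p ≡ q → p - q ≡ 0ℚ
p≡q⇒p-q≡0 {p} refl = +-inverseʳ p

≤∧≢⇒< : ∀ {p q} → p ≤ q → p ≢ q → p < q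
≤∧≢⇒< {p} {q} p≤q p≢q with <-cmp p q
... | tri< p<q _ _ = p<q
... | tri≈ _ p≡q _ = ⊥-elim (p≢q p≡q)
... | tri> _ _ q<p = ⊥-elim (<-irrefl refl (<-≤-trans q<p p≤q))

pos⇒≢0 : ∀ {p} → 0ℚ < p → p ≢ 0ℚ
pos⇒≢0 0<p p≡0 = <-irrefl (sym p≡0) 0<p

*-pos : ∀ {p q} → 0ℚ < p → 0ℚ < q → 0ℚ < p * q
*-pos {p} {q} 0<p 0<q = positive⁻¹ _ {{pos*pos⇒pos p {{positive 0<p}} q {{positive 0<q}}}}

*-nonNeg : ∀ {p q} → 0ℚ ≤ p → 0ℚ ≤ q → 0ℚ ≤ p * q
*-nonNeg {p} {q} 0≤p 0≤q = nonNegative⁻¹ _ {{nonNeg*nonNeg⇒nonNeg p {{nonNegative 0≤p}} q {{nonNegative 0≤q}}}}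

0≤p*p : ∀ p → 0ℚ ≤ p * p
0≤p*p p with ≤-total 0ℚ p
... | inj₁ 0≤p = *-nonNeg 0≤p 0≤p
... | inj₂ p≤0 = nonNegative⁻¹ _ {{nonPos*nonPos⇒nonPos p {{nonPositive p≤0}} p {{nonPositive p≤0}}}}

nonNeg+nonNeg≡0⇒≡0 : ∀ {p q} → 0ℚ ≤ p → 0ℚ ≤ q → p + q ≡ 0ℚ → p ≡ 0ℚ
nonNeg+nonNeg≡0⇒≡0 {p} {q} 0≤p 0≤q p+q≡0 =
  ≤-antisym (subst₂ _≤_ (+-identityʳ p) p+q≡0 (+-monoʳ-≤ p 0≤q)) 0≤p

*-inv : ∀ p → p ≢ 0ℚ → p * inv p ≡ 1ℚ
*-inv p@(mkℚ (+ suc _) _ _) _   = *-inverseʳ p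
*-inv p@(mkℚ -[1+ _ ] _ _)  _   = *-inverseʳ p
*-inv p@(mkℚ (+ zero) _ _)  p≢0 = ⊥-elim (p≢0 (↥p≡0⇒p≡0 p refl))

inv-pos : ∀ {p} → 0ℚ < p → 0ℚ < inv p
inv-pos {p@(mkℚ (+ suc _) _ _)} _ = positive⁻¹ _ {{1/pos⇒pos p}}
inv-pos {p@(mkℚ -[1+ _ ] _ _)} 0<p = ⊥-elim (<-asym 0<p (negative⁻¹ p))
inv-pos {p@(mkℚ (+ zero) _ _)} 0<p = ⊥-elim (pos⇒≢0 0<p (↥p≡0⇒p≡0 p refl))

p*q≡0⇒p≡0⊎q≡0 : ∀ p q → p * q ≡ 0ℚ → p ≡ 0ℚ ⊎ q ≡ 0ℚ
p*q≡0⇒p≡0⊎q≡0 p q pq≡0 with p ≟ 0ℚ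
... | yes p≡0 = inj₁ p≡0
... | no  p≢0 = inj₂ (begin
  q                                      ≡⟨ rearrange p q (inv p) ⟩
  (p * q) * inv p - q * (p * inv p - 1ℚ) ≡⟨ cong₂ (λ x y → x * inv p - q * (y - 1ℚ)) pq≡0 (*-inv p p≢0) ⟩
  0ℚ * inv p - q * (1ℚ - 1ℚ)             ≡⟨ vanish q (inv p) ⟩
  0ℚ                                     ∎)
  where
  open ≡-Reasoning
  rearrange : ∀ p q r → q ≡ (p * q) * r - q * (p * r - 1ℚ)
  rearrange = solve-∀ ℚ-ring
  vanish : ∀ q r → 0ℚ * r - q * (1ℚ - 1ℚ) ≡ 0ℚ
  vanish = solve-∀ ℚ-ring

*-cancelˡ-≡ : ∀ {c p q} → c ≢ 0ℚ → c * p ≡ c * q → p ≡ q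
*-cancelˡ-≡ {c} {p} {q} c≢0 cp≡cq =
  Sum.[ ⊥-elim ∘ c≢0 , p-q≡0⇒p≡q {p} {q} ] (p*q≡0⇒p≡0⊎q≡0 c (p - q) c[p-q]≡0)
  where
  distrib : ∀ c p q → c * (p - q) ≡ c * p - c * q
  distrib = solve-∀ ℚ-ring
  c[p-q]≡0 : c * (p - q) ≡ 0ℚ
  c[p-q]≡0 = trans (distrib c p q) (trans (cong (_- c * q) cp≡cq) (+-inverseʳ (c * q)))

p*p≡0⇒p≡0 : ∀ p → p * p ≡ 0ℚ → p ≡ 0ℚ
p*p≡0⇒p≡0 p pp≡0 = Sum.reduce (p*q≡0⇒p≡0⊎q≡0 p p pp≡0)

0≤2p⇒0≤p : ∀ {p} → 0ℚ ≤ 2ℚ * p → 0ℚ ≤ p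
0≤2p⇒0≤p {p} 0≤2p = *-cancelˡ-≤-pos 2ℚ (subst (_≤ 2ℚ * p) (sym (*-zeroʳ 2ℚ)) 0≤2p)

2*-injective : ∀ {p q} → 2ℚ * p ≡ 2ℚ * q → p ≡ q
2*-injective = *-cancelˡ-≡ {2ℚ} (λ ())

fromℕ-suc : ∀ n → fromℕ (suc n) ≡ 1ℚ + fromℕ n
fromℕ-suc n = toℚᵘ-injective (begin
  toℚᵘ (fromℕ (suc n))
    ≈⟨ toℚᵘ-fromℚᵘ (ℚᵘ.mkℚᵘ (+ suc n) 0) ⟩
  ℚᵘ.mkℚᵘ (+ suc n) 0
    ≈⟨ ℚᵘ.*≡* (solve 1 (λ x → (1ᶻ :+ x) :* (1ᶻ :* 1ᶻ) := (1ᶻ :* 1ᶻ :+ x :* 1ᶻ) :* 1ᶻ) refl (+ n)) ⟩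
  ℚᵘ.1ℚᵘ ℚᵘ.+ ℚᵘ.mkℚᵘ (+ n) 0
    ≈⟨ ℚᵘₚ.+-cong {ℚᵘ.1ℚᵘ} {toℚᵘ 1ℚ} (ℚᵘ.*≡* refl) (ℚᵘₚ.≃-sym (toℚᵘ-fromℚᵘ (ℚᵘ.mkℚᵘ (+ n) 0))) ⟩
  toℚᵘ 1ℚ ℚᵘ.+ toℚᵘ (fromℕ n)
    ≈⟨ ℚᵘₚ.≃-sym (toℚᵘ-homo-+ 1ℚ (fromℕ n)) ⟩
  toℚᵘ (1ℚ + fromℕ n) ∎)
  where
  open ℚᵘₚ.≃-Reasoning
  open ℤ-Solver.+-*-Solver using (Polynomial; solve; con; _:+_; _:*_; _:=_)
  1ᶻ : ∀ {m} → Polynomial m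
  1ᶻ = con (+ 1)

fromℕ-pos : ∀ n .⦃ _ : ℕ.NonZero n ⦄ → 0ℚ < fromℕ n
fromℕ-pos (suc n) = positive⁻¹ _ {{normalize-pos (suc n) 1}}

/-*-fromℕ : ∀ m d → (+ m / suc d) * fromℕ (suc d) ≡ fromℕ m
/-*-fromℕ m d = toℚᵘ-injective (begin
  toℚᵘ ((+ m / suc d) * fromℕ (suc d))
    ≈⟨ toℚᵘ-homo-* (+ m / suc d) (fromℕ (suc d)) ⟩
  toℚᵘ (+ m / suc d) ℚᵘ.* toℚᵘ (fromℕ (suc d))
    ≈⟨ ℚᵘₚ.*-cong (toℚᵘ-fromℚᵘ (ℚᵘ.mkℚᵘ (+ m) d)) (toℚᵘ-fromℚᵘ (ℚᵘ.mkℚᵘ (+ suc d) 0)) ⟩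
  ℚᵘ.mkℚᵘ (+ m) d ℚᵘ.* ℚᵘ.mkℚᵘ (+ suc d) 0
    ≈⟨ ℚᵘ.*≡* (solve 2 (λ a b → (a :* b) :* con (+ 1) := a :* (b :* con (+ 1))) refl (+ m) (+ suc d)) ⟩
  ℚᵘ.mkℚᵘ (+ m) 0
    ≈⟨ ℚᵘₚ.≃-sym (toℚᵘ-fromℚᵘ (ℚᵘ.mkℚᵘ (+ m) 0)) ⟩
  toℚᵘ (fromℕ m) ∎)
  where
  open ℚᵘₚ.≃-Reasoning
  open ℤ-Solver.+-*-Solver using (solve; con; _:*_; _:=_)

-- Finite sums over the vertices

∑-distrib-- : ∀ {n} (f g : Fin n → ℚ) → sum (λ k → f k - g k) ≡ sum f - sum g
∑-distrib-- {zero}  f g = refl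
∑-distrib-- {suc n} f g = trans (cong (_+_ (f zero - g zero)) (∑-distrib-- (f ∘ suc) (g ∘ suc)))
  (regroup (f zero) (g zero) (sum (f ∘ suc)) (sum (g ∘ suc)))
  where
  regroup : ∀ a b c d → a - b + (c - d) ≡ a + c - (b + d)
  regroup = solve-∀ ℚ-ring

∑-neg : ∀ {n} (f : Fin n → ℚ) → sum (λ k → - f k) ≡ - sum f
∑-neg {zero}  f = refl
∑-neg {suc n} f = trans (cong (_+_ (- f zero)) (∑-neg (f ∘ suc))) (sym (neg-distrib-+ (f zero) (sum (f ∘ suc))))

sum-const : ∀ n c → sum {n} (λ _ → c) ≡ fromℕ n * c
sum-const zero    c = sym (*-zeroˡ c)
sum-const (suc n) c = begin
  c + sum {n} (λ _ → c)  ≡⟨ cong (_+_ c) (sum-const n c) ⟩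
  c + fromℕ n * c       ≡⟨ regroup c (fromℕ n) ⟩
  (1ℚ + fromℕ n) * c    ≡⟨ cong (_* c) (fromℕ-suc n) ⟨
  fromℕ (suc n) * c     ∎
  where
  open ≡-Reasoning
  regroup : ∀ c m → c + m * c ≡ (1ℚ + m) * c
  regroup = solve-∀ ℚ-ring

sum-mono-≤ : ∀ {n} {f g : Fin n → ℚ} → (∀ k → f k ≤ g k) → sum f ≤ sum g
sum-mono-≤ {zero}  f≤g = ≤-refl
sum-mono-≤ {suc n} f≤g = +-mono-≤ (f≤g zero) (sum-mono-≤ (f≤g ∘ suc))

sum-nonNeg : ∀ {n} {f : Fin n → ℚ} → (∀ k → 0ℚ ≤ f k) → 0ℚ ≤ sum f
sum-nonNeg {n} {f} 0≤f = subst (_≤ sum f) (sum-replicate-zero n) (sum-mono-≤ 0≤f)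

term≤sum : ∀ {n} {f : Fin n → ℚ} → (∀ k → 0ℚ ≤ f k) → ∀ k → f k ≤ sum f
term≤sum {suc n} {f} 0≤f zero =
  subst (_≤ sum f) (+-identityʳ (f zero)) (+-monoʳ-≤ (f zero) (sum-nonNeg (0≤f ∘ suc)))
term≤sum {suc n} {f} 0≤f (suc k) =
  subst (_≤ sum f) (+-identityˡ (f (suc k))) (+-mono-≤ (0≤f zero) (term≤sum (0≤f ∘ suc) k))

term+term≤sum : ∀ {n} {f : Fin n → ℚ} → (∀ k → 0ℚ ≤ f k) → ∀ k l → k ≢ l → f k + f l ≤ sum f
term+term≤sum {suc n} {f} 0≤f zero zero k≢l = ⊥-elim (k≢l refl)
term+term≤sum {suc n} {f} 0≤f zero (suc l) _ = +-monoʳ-≤ (f zero) (term≤sum (0≤f ∘ suc) l)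
term+term≤sum {suc n} {f} 0≤f (suc k) zero _ =
  subst (_≤ sum f) (+-comm (f zero) (f (suc k))) (+-monoʳ-≤ (f zero) (term≤sum (0≤f ∘ suc) k))
term+term≤sum {suc n} {f} 0≤f (suc k) (suc l) k≢l =
  subst (_≤ sum f) (+-identityˡ _) (+-mono-≤ (0≤f zero) (term+term≤sum (0≤f ∘ suc) k l (k≢l ∘ cong suc)))

nonNeg-sum≤0⇒≡0 : ∀ {n} {f : Fin n → ℚ} → (∀ k → 0ℚ ≤ f k) → sum f ≤ 0ℚ → ∀ k → f k ≡ 0ℚ
nonNeg-sum≤0⇒≡0 0≤f sum≤0 k = ≤-antisym (≤-trans (term≤sum 0≤f k) sum≤0) (0≤f k)

nonNeg-sum≤term⇒others≡0 : ∀ {n} {f : Fin n → ℚ} → (∀ k → 0ℚ ≤ f k) →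
                            ∀ {l} → sum f ≤ f l → ∀ {k} → k ≢ l → f k ≡ 0ℚ
nonNeg-sum≤term⇒others≡0 {f = f} 0≤f {l} sum≤fl {k} k≢l = ≤-antisym fk≤0 (0≤f k)
  where
  cancel : ∀ p q → p + q - q ≡ p
  cancel = solve-∀ ℚ-ring
  fk≤0 : f k ≤ 0ℚ
  fk≤0 = subst₂ _≤_ (cancel (f k) (f l)) (+-inverseʳ (f l))
           (+-monoˡ-≤ (- f l) (≤-trans (term+term≤sum 0≤f k l k≢l) sum≤fl))

pos-sum⇒pos-term : ∀ {n} (f : Fin n → ℚ) → 0ℚ < sum f → ∃ λ k → 0ℚ < f k
pos-sum⇒pos-term f 0<sum with Finₚ.any? (λ k → 0ℚ <? f k)
... | yes found = found
... | no  none  = ⊥-elim (<-irrefl refl (<-≤-trans 0<sum (neg-cancel-≤ 0≤-sum)))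
  where
  -f≥0 : ∀ k → 0ℚ ≤ - f k
  -f≥0 k = neg-antimono-≤ (≮⇒≥ (λ 0<fk → none (k , 0<fk)))
  0≤-sum : - 0ℚ ≤ - sum f
  0≤-sum = subst (0ℚ ≤_) (∑-neg f) (sum-nonNeg -f≥0)

δ-diag : ∀ {n} (a : Fin n) → δ a a ≡ 1ℚ
δ-diag zero    = refl
δ-diag (suc a) = δ-diag a

δ-off : ∀ {n} {a k : Fin n} → k ≢ a → δ a k ≡ 0ℚ
δ-off {a = zero}  {zero}  k≢a = ⊥-elim (k≢a refl)
δ-off {a = zero}  {suc k} _   = refl
δ-off {a = suc a} {zero}  _   = refl
δ-off {a = suc a} {suc k} k≢a = δ-off (k≢a ∘ cong suc)

δ-comm : ∀ {n} (a k : Fin n) → δ a k ≡ δ k a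
δ-comm a k with k ≟ᶠ a
... | yes refl = sym (δ-diag a)
... | no  k≢a  = sym (δ-off (k≢a ∘ sym))

δ-nonNeg : ∀ {n} (a k : Fin n) → 0ℚ ≤ δ a k
δ-nonNeg a k with k ≟ᶠ a
... | yes _ = nonNegative⁻¹ 1ℚ
... | no  _ = ≤-refl

sum-δ* : ∀ {n} (a : Fin n) (g : Fin n → ℚ) → sum (λ k → δ a k * g k) ≡ g a
sum-δ* {suc n} zero g =
  trans (cong₂ _+_ (*-identityˡ (g zero)) (trans (sum-cong-≗ (λ k → *-zeroˡ (g (suc k)))) (sum-replicate-zero n)))
        (+-identityʳ (g zero))
sum-δ* {suc n} (suc a) g = trans (cong₂ _+_ (*-zeroˡ (g zero)) (sum-δ* a (g ∘ suc))) (+-identityˡ _)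

sum-δ : ∀ {n} (a : Fin n) → sum (δ a) ≡ 1ℚ
sum-δ a = trans (sum-cong-≗ (λ k → sym (*-identityʳ (δ a k)))) (sum-δ* a (λ _ → 1ℚ))

pos-sum-except⇒pos-term : ∀ {n} (f : Fin n → ℚ) p → 0ℚ < sum f - f p → ∃ λ q → q ≢ p × 0ℚ < f q
pos-sum-except⇒pos-term f p 0<rest with pos-sum⇒pos-term g (subst (0ℚ <_) (sym sum-g) 0<rest)
  where
  g : Fin _ → ℚ
  g q = f q - δ p q * f q
  sum-g : sum g ≡ sum f - f p
  sum-g = trans (∑-distrib-- f (λ q → δ p q * f q)) (cong (_-_ (sum f)) (sum-δ* p f))
... | q , 0<gq with q ≟ᶠ p
...   | yes refl = ⊥-elim (<-irrefl (sym (trans (cong (_-_ (f q)) (*-identityˡ (f q))) (+-inverseʳ (f q)))) 0<gq)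
...   | no  q≢p  = q , q≢p , subst (0ℚ <_) (trans (cong (λ x → f q - x) (*-zeroˡ (f q))) (+-identityʳ (f q))) 0<gq

argmax : ∀ {n} (f : Fin n → ℚ) → Fin n → ∃ λ m → ∀ l → f l ≤ f m
argmax {suc zero}    f _ = zero , λ { zero → ≤-refl }
argmax {suc (suc n)} f _ with argmax (f ∘ suc) zero
... | m , max with ≤-total (f zero) (f (suc m))
...   | inj₁ f0≤fm = suc m , λ { zero → f0≤fm ; (suc l) → max l }
...   | inj₂ fm≤f0 = zero , λ { zero → ≤-refl ; (suc l) → ≤-trans (max l) fm≤f0 }

sumV≡sum : ∀ {n} (f : Fin n → ℚ) → sumV f ≡ sum f
sumV≡sum {n} f = trans (cong (foldr _+_ 0ℚ) (Listₚ.map-tabulate id f)) (go n f)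
  where
  go : ∀ n (f : Fin n → ℚ) → foldr _+_ 0ℚ (tabulate f) ≡ sum f
  go zero    f = refl
  go (suc n) f = cong (_+_ (f zero)) (go n (f ∘ suc))

isBelow : ℚ → ℚ → ℕ
isBelow p c with p <? c
... | yes _ = 1
... | no  _ = 0

isBelow-mono : ∀ p {c c′} → c ≤ c′ → isBelow p c ℕ.≤ isBelow p c′
isBelow-mono p {c} {c′} c≤c′ with p <? c | p <? c′
... | yes _   | yes _    = ℕₚ.≤-refl
... | yes p<c | no  p≮c′ = ⊥-elim (p≮c′ (<-≤-trans p<c c≤c′))
... | no  _   | _        = ℕ.z≤n

countBelow : ∀ {n} → (Fin n → ℚ) → ℚ → ℕ
countBelow {zero}  f c = 0
countBelow {suc n} f c = isBelow (f zero) c ℕ.+ countBelow (f ∘ suc) c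

countBelow-mono : ∀ {n} (f : Fin n → ℚ) {c c′} → c ≤ c′ → countBelow f c ℕ.≤ countBelow f c′
countBelow-mono {zero}  f c≤c′ = ℕ.z≤n
countBelow-mono {suc n} f c≤c′ = ℕₚ.+-mono-≤ (isBelow-mono (f zero) c≤c′) (countBelow-mono (f ∘ suc) c≤c′)

countBelow-< : ∀ {n} (f : Fin n → ℚ) {a c} → f a < c → countBelow f (f a) ℕ.< countBelow f c
countBelow-< {suc n} f {zero} {c} fa<c with f zero <? f zero | f zero <? c
... | yes f0<f0 | _        = ⊥-elim (<-irrefl refl f0<f0)
... | no  _     | yes _    = ℕ.s≤s (countBelow-mono (f ∘ suc) (<⇒≤ fa<c))
... | no  _     | no  f0≮c = ⊥-elim (f0≮c fa<c)
countBelow-< {suc n} f {suc a} fa<c =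
  ℕₚ.+-mono-≤-< (isBelow-mono (f zero) (<⇒≤ fa<c)) (countBelow-< (f ∘ suc) fa<c)

All-last : ∀ {m} {P : Fin m → Set} {r rs} → All P (r ∷ rs) → P (last r rs)
All-last {rs = []}     (p ∷ []) = p
All-last {rs = _ ∷ _}  (_ ∷ ps) = All-last ps

-- Sums over pairs of vertices and over edges

sum₂ : ∀ {n} → (Fin n → Fin n → ℚ) → ℚ
sum₂ f = sum λ i → sum λ j → f i j

sum₂-cong : ∀ {n} {f g : Fin n → Fin n → ℚ} → (∀ i j → f i j ≡ g i j) → sum₂ f ≡ sum₂ g
sum₂-cong f≡g = sum-cong-≗ λ i → sum-cong-≗ (f≡g i)

sum₂-zero : ∀ n → sum₂ {n} (λ _ _ → 0ℚ) ≡ 0ℚ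
sum₂-zero n = trans (sum-cong-≗ {n} {λ _ → sum {n} (λ _ → 0ℚ)} (λ _ → sum-replicate-zero n)) (sum-replicate-zero n)

∑₂-distrib-+ : ∀ {n} (f g : Fin n → Fin n → ℚ) → sum₂ (λ i j → f i j + g i j) ≡ sum₂ f + sum₂ g
∑₂-distrib-+ f g = trans (sum-cong-≗ λ i → ∑-distrib-+ (f i) (g i)) (∑-distrib-+ (λ i → sum (f i)) (λ i → sum (g i)))

∑₂-distrib-- : ∀ {n} (f g : Fin n → Fin n → ℚ) → sum₂ (λ i j → f i j - g i j) ≡ sum₂ f - sum₂ g
∑₂-distrib-- f g = trans (sum-cong-≗ λ i → ∑-distrib-- (f i) (g i)) (∑-distrib-- (λ i → sum (f i)) (λ i → sum (g i)))

*-distribˡ-sum₂ : ∀ {n} c (f : Fin n → Fin n → ℚ) → sum₂ (λ i j → c * f i j) ≡ c * sum₂ f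
*-distribˡ-sum₂ c f = trans (sum-cong-≗ λ i → sym (*-distribˡ-sum c (f i))) (sym (*-distribˡ-sum c (λ i → sum (f i))))

sum₂-transpose : ∀ {n} (f : Fin n → Fin n → ℚ) → sum₂ (λ i j → f j i) ≡ sum₂ f
sum₂-transpose f = ∑-comm (λ i j → f j i)

sum₂-nonNeg : ∀ {n} {f : Fin n → Fin n → ℚ} → (∀ i j → 0ℚ ≤ f i j) → 0ℚ ≤ sum₂ f
sum₂-nonNeg 0≤f = sum-nonNeg λ i → sum-nonNeg (0≤f i)

nonNeg-sum₂≤0⇒≡0 : ∀ {n} {f : Fin n → Fin n → ℚ} → (∀ i j → 0ℚ ≤ f i j) → sum₂ f ≤ 0ℚ → ∀ i j → f i j ≡ 0ℚ
nonNeg-sum₂≤0⇒≡0 0≤f sum≤0 i =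
  nonNeg-sum≤0⇒≡0 (0≤f i) (≤-reflexive (nonNeg-sum≤0⇒≡0 (λ i → sum-nonNeg (0≤f i)) sum≤0 i))

restrict : ∀ {n} → (Fin n → Fin n → Bool) → (Fin n → Fin n → ℚ) → Fin n → Fin n → ℚ
restrict E f i j = if E i j then f i j else 0ℚ

sumOn : ∀ {n} → (Fin n → Fin n → Bool) → (Fin n → Fin n → ℚ) → ℚ
sumOn E f = sum₂ (restrict E f)

module _ {n} (E : Fin n → Fin n → Bool) where

  sumOn-cong : ∀ {f g} → (∀ i j → E i j ≡ true → f i j ≡ g i j) → sumOn E f ≡ sumOn E g
  sumOn-cong {f} {g} f≡g = sum₂-cong restrict-cong
    where
    restrict-cong : ∀ i j → restrict E f i j ≡ restrict E g i j
    restrict-cong i j with E i j in Eij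
    ... | true  = f≡g i j Eij
    ... | false = refl

  sumOn-zero : sumOn E (λ _ _ → 0ℚ) ≡ 0ℚ
  sumOn-zero = trans (sum₂-cong λ i j → restrict-zero (E i j)) (sum₂-zero n)
    where
    restrict-zero : ∀ b → (if b then 0ℚ else 0ℚ) ≡ 0ℚ
    restrict-zero true  = refl
    restrict-zero false = refl

  restrict-nonNeg : ∀ {f} → (∀ i j → E i j ≡ true → 0ℚ ≤ f i j) → ∀ i j → 0ℚ ≤ restrict E f i j
  restrict-nonNeg {f} 0≤f i j with E i j in Eij
  ... | true  = 0≤f i j Eij
  ... | false = ≤-refl

  sumOn-nonNeg : ∀ {f} → (∀ i j → E i j ≡ true → 0ℚ ≤ f i j) → 0ℚ ≤ sumOn E f
  sumOn-nonNeg 0≤f = sum₂-nonNeg (restrict-nonNeg 0≤f)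

  nonNeg-sumOn≡0⇒≡0 : ∀ {f} → (∀ i j → E i j ≡ true → 0ℚ ≤ f i j) → sumOn E f ≡ 0ℚ →
                      ∀ i j → E i j ≡ true → f i j ≡ 0ℚ
  nonNeg-sumOn≡0⇒≡0 {f} 0≤f sum≡0 i j Eij =
    subst (λ b → (if b then f i j else 0ℚ) ≡ 0ℚ) Eij
      (nonNeg-sum₂≤0⇒≡0 (restrict-nonNeg 0≤f) (≤-reflexive sum≡0) i j)

  sumOn-affine : ∀ a b c f g → sumOn E (λ i j → a * f i j + b * g i j - c) ≡ a * sumOn E f + b * sumOn E g - c * sumOn E (λ _ _ → 1ℚ)
  sumOn-affine a b c f g = begin
    sum₂ (restrict E (λ i j → a * f i j + b * g i j - c))
      ≡⟨ sum₂-cong (λ i j → pointwise (E i j)) ⟩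
    sum₂ (λ i j → a * F i j + b * G i j - c * I i j)
      ≡⟨ ∑₂-distrib-- (λ i j → a * F i j + b * G i j) (λ i j → c * I i j) ⟩
    sum₂ (λ i j → a * F i j + b * G i j) - sum₂ (λ i j → c * I i j)
      ≡⟨ cong₂ _-_ (∑₂-distrib-+ (λ i j → a * F i j) (λ i j → b * G i j)) (*-distribˡ-sum₂ c I) ⟩
    sum₂ (λ i j → a * F i j) + sum₂ (λ i j → b * G i j) - c * sum₂ I
      ≡⟨ cong₂ (λ p q → p + q - c * sum₂ I) (*-distribˡ-sum₂ a F) (*-distribˡ-sum₂ b G) ⟩
    a * sumOn E f + b * sumOn E g - c * sumOn E (λ _ _ → 1ℚ) ∎
    where
    open ≡-Reasoning
    F G I : Fin n → Fin n → ℚ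
    F = restrict E f
    G = restrict E g
    I = restrict E (λ _ _ → 1ℚ)
    pointwise : ∀ {i j} e → (if e then a * f i j + b * g i j - c else 0ℚ)
              ≡ a * (if e then f i j else 0ℚ) + b * (if e then g i j else 0ℚ) - c * (if e then 1ℚ else 0ℚ)
    pointwise true  = cong (_-_ (a * _ + b * _)) (sym (*-identityʳ c))
    pointwise false = vanish a b c
      where
      vanish : ∀ a b c → 0ℚ ≡ a * 0ℚ + b * 0ℚ - c * 0ℚ
      vanish = solve-∀ ℚ-ring

listSum : List ℚ → ℚ
listSum = foldr _+_ 0ℚ

listSum-++ : ∀ xs ys → listSum (xs ++ ys) ≡ listSum xs + listSum ys
listSum-++ []       ys = sym (+-identityˡ (listSum ys))
listSum-++ (x ∷ xs) ys = trans (cong (_+_ x) (listSum-++ xs ys)) (sym (+-assoc x (listSum xs) (listSum ys)))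

listSum-concatMap : ∀ {A B : Set} (h : B → ℚ) (g : A → List B) xs →
                    listSum (map h (concatMap g xs)) ≡ listSum (map (λ x → listSum (map h (g x))) xs)
listSum-concatMap h g []       = refl
listSum-concatMap h g (x ∷ xs) = begin
  listSum (map h (g x ++ concatMap g xs))
    ≡⟨ cong listSum (Listₚ.map-++ h (g x) (concatMap g xs)) ⟩
  listSum (map h (g x) ++ map h (concatMap g xs))
    ≡⟨ listSum-++ (map h (g x)) (map h (concatMap g xs)) ⟩
  listSum (map h (g x)) + listSum (map h (concatMap g xs))
    ≡⟨ cong (_+_ (listSum (map h (g x)))) (listSum-concatMap h g xs) ⟩
  listSum (map h (g x)) + listSum (map (λ x → listSum (map h (g x))) xs) ∎
  where open ≡-Reasoning

edgeSum : ∀ {n} → Graph n → (Fin n → Fin n → ℚ) → ℚ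
edgeSum G f = listSum (map (λ e → f (proj₁ e) (proj₂ e)) (edges G))

fromℕ-length : ∀ {A : Set} (xs : List A) → fromℕ (length xs) ≡ listSum (map (λ _ → 1ℚ) xs)
fromℕ-length []       = refl
fromℕ-length (x ∷ xs) = trans (fromℕ-suc (length xs)) (cong (_+_ 1ℚ) (fromℕ-length xs))

fromℕ-numEdges : ∀ {n} (G : Graph n) → fromℕ (numEdges G) ≡ edgeSum G (λ _ _ → 1ℚ)
fromℕ-numEdges G = fromℕ-length (edges G)

<ᵇ-true : ∀ {m n} → m ℕ.< n → (m <ᵇ n) ≡ true
<ᵇ-true m<n = Equivalence.to Boolₚ.T-≡ (ℕₚ.<⇒<ᵇ m<n)

<ᵇ-false : ∀ {m n} → ¬ m ℕ.< n → (m <ᵇ n) ≡ false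
<ᵇ-false {m} {n} m≮n with m <ᵇ n in m<ᵇn
... | false = refl
... | true  = ⊥-elim (m≮n (ℕₚ.<ᵇ⇒< m n (subst T (sym m<ᵇn) tt)))

module _ {n} (G : Graph n) where

  private
    upper : (Fin n → Fin n → ℚ) → Fin n → Fin n → ℚ
    upper f i j = if adj G i j ∧ (toℕ i <ᵇ toℕ j) then f i j else 0ℚ

  edgeSum≡sum₂-upper : ∀ f → edgeSum G f ≡ sum₂ (upper f)
  edgeSum≡sum₂-upper f = begin
    listSum (map h (concatMap (λ i → concatMap (row i) (allFin n)) (allFin n)))
      ≡⟨ listSum-concatMap h _ (allFin n) ⟩
    listSum (map (λ i → listSum (map h (concatMap (row i) (allFin n)))) (allFin n))
      ≡⟨ cong listSum (Listₚ.map-cong (λ i → listSum-concatMap h (row i) (allFin n)) (allFin n)) ⟩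
    listSum (map (λ i → listSum (map (λ j → listSum (map h (row i j))) (allFin n))) (allFin n))
      ≡⟨ cong listSum (Listₚ.map-cong (λ i → cong listSum (Listₚ.map-cong (entry i) (allFin n))) (allFin n)) ⟩
    listSum (map (λ i → listSum (map (upper f i) (allFin n))) (allFin n))
      ≡⟨ cong listSum (Listₚ.map-cong (λ i → sumV≡sum (upper f i)) (allFin n)) ⟩
    listSum (map (λ i → sum (upper f i)) (allFin n))
      ≡⟨ sumV≡sum (λ i → sum (upper f i)) ⟩
    sum₂ (upper f) ∎
    where
    open ≡-Reasoning
    h : Fin n × Fin n → ℚ
    h e = f (proj₁ e) (proj₂ e)
    row : Fin n → Fin n → List (Fin n × Fin n)
    row i j = if adj G i j ∧ (toℕ i <ᵇ toℕ j) then [ (i , j) ] else []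
    entry : ∀ i j → listSum (map h (row i j)) ≡ upper f i j
    entry i j with adj G i j ∧ (toℕ i <ᵇ toℕ j)
    ... | true  = +-identityʳ (f i j)
    ... | false = refl

  upper+lower : ∀ f → (∀ i j → f i j ≡ f j i) → ∀ i j → upper f i j + upper f j i ≡ restrict (adj G) f i j
  upper+lower f f-sym i j with ℕₚ.<-cmp (toℕ i) (toℕ j)
  ... | tri< i<j _ _ rewrite <ᵇ-true i<j | <ᵇ-false (ℕₚ.<⇒≯ i<j) | Graph.sym G j i with adj G i j
  ...   | true  = +-identityʳ (f i j)
  ...   | false = refl
  upper+lower f f-sym i j | tri≈ _ i≡j _ rewrite Finₚ.toℕ-injective i≡j | irrefl G j = refl
  upper+lower f f-sym i j | tri> _ _ j<i rewrite <ᵇ-true j<i | <ᵇ-false (ℕₚ.<⇒≯ j<i) | Graph.sym G j i with adj G i j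
  ...   | true  = trans (+-identityˡ (f j i)) (sym (f-sym i j))
  ...   | false = refl

  2*edgeSum≡sumOn : ∀ f → (∀ i j → f i j ≡ f j i) → 2ℚ * edgeSum G f ≡ sumOn (adj G) f
  2*edgeSum≡sumOn f f-sym = begin
    2ℚ * edgeSum G f                            ≡⟨ double (edgeSum G f) ⟩
    edgeSum G f + edgeSum G f                   ≡⟨ cong₂ _+_ (edgeSum≡sum₂-upper f) lower ⟩
    sum₂ (upper f) + sum₂ (λ i j → upper f j i) ≡⟨ ∑₂-distrib-+ (upper f) (λ i j → upper f j i) ⟨
    sum₂ (λ i j → upper f i j + upper f j i)    ≡⟨ sum₂-cong (upper+lower f f-sym) ⟩
    sumOn (adj G) f                             ∎
    where
    open ≡-Reasoning
    double : ∀ x → 2ℚ * x ≡ x + x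
    double = solve-∀ ℚ-ring
    lower : edgeSum G f ≡ sum₂ (λ i j → upper f j i)
    lower = trans (edgeSum≡sum₂-upper f) (sym (sum₂-transpose (upper f)))

module CauchySchwarz {n} (E : Fin n → Fin n → Bool) (x : Fin n → Fin n → ℚ)
                     (x-pos : ∀ i j → E i j ≡ true → 0ℚ < x i j) where

  y : Fin n → Fin n → ℚ
  y i j = inv (x i j)

  Sx Sy S1 : ℚ
  Sx = sumOn E x
  Sy = sumOn E y
  S1 = sumOn E (λ _ _ → 1ℚ)

  x*y≡1 : ∀ i j → E i j ≡ true → x i j * y i j ≡ 1ℚ
  x*y≡1 i j Eij = *-inv (x i j) (pos⇒≢0 (x-pos i j Eij))

  pairTerm : Fin n → Fin n → Fin n → Fin n → ℚ
  pairTerm i j k l = (x i j - x k l) * (x i j - x k l) * (y i j * y k l)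

  pairTerm-expand : ∀ i j k l → E i j ≡ true → E k l ≡ true →
                    pairTerm i j k l ≡ x i j * y k l + y i j * x k l - 2ℚ
  pairTerm-expand i j k l Eij Ekl = begin
    (p - q) * (p - q) * (p⁻¹ * q⁻¹) ≡⟨ expand p q p⁻¹ q⁻¹ ⟩
    rest (p * p⁻¹) (q * q⁻¹)        ≡⟨ cong₂ rest (x*y≡1 i j Eij) (x*y≡1 k l Ekl) ⟩
    rest 1ℚ 1ℚ                      ≡⟨ simplify (p * q⁻¹) (p⁻¹ * q) ⟩
    p * q⁻¹ + p⁻¹ * q - 2ℚ          ∎
    where
    open ≡-Reasoning
    p q p⁻¹ q⁻¹ : ℚ
    p = x i j
    q = x k l
    p⁻¹ = y i j
    q⁻¹ = y k l
    rest : ℚ → ℚ → ℚ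
    rest u v = p * q⁻¹ + p⁻¹ * q - 2ℚ * (u * v) + (p * q⁻¹) * (u - 1ℚ) + (p⁻¹ * q) * (v - 1ℚ)
    expand : ∀ p q p⁻¹ q⁻¹ → (p - q) * (p - q) * (p⁻¹ * q⁻¹)
           ≡ p * q⁻¹ + p⁻¹ * q - 2ℚ * ((p * p⁻¹) * (q * q⁻¹)) + (p * q⁻¹) * (p * p⁻¹ - 1ℚ) + (p⁻¹ * q) * (q * q⁻¹ - 1ℚ)
    expand = solve-∀ ℚ-ring
    simplify : ∀ a b → a + b - 2ℚ * (1ℚ * 1ℚ) + a * (1ℚ - 1ℚ) + b * (1ℚ - 1ℚ) ≡ a + b - 2ℚ
    simplify = solve-∀ ℚ-ring

  lagrange : sumOn E (λ i j → sumOn E (pairTerm i j)) ≡ 2ℚ * (Sx * Sy - S1 * S1)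
  lagrange = begin
    sumOn E (λ i j → sumOn E (pairTerm i j))
      ≡⟨ sumOn-cong E (λ i j Eij → sumOn-cong E (λ k l → pairTerm-expand i j k l Eij)) ⟩
    sumOn E (λ i j → sumOn E (λ k l → x i j * y k l + y i j * x k l - 2ℚ))
      ≡⟨ sumOn-cong E (λ i j _ → trans (sumOn-affine E (x i j) (y i j) 2ℚ y x) (swap (x i j) (y i j))) ⟩
    sumOn E (λ i j → Sy * x i j + Sx * y i j - 2ℚ * S1)
      ≡⟨ sumOn-affine E Sy Sx (2ℚ * S1) x y ⟩
    Sy * Sx + Sx * Sy - 2ℚ * S1 * S1
      ≡⟨ collect Sx Sy S1 ⟩
    2ℚ * (Sx * Sy - S1 * S1) ∎
    where
    open ≡-Reasoning
    swap : ∀ a b → a * Sy + b * Sx - 2ℚ * S1 ≡ Sy * a + Sx * b - 2ℚ * S1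
    swap a b = cong₂ (λ u v → u + v - 2ℚ * S1) (*-comm a Sy) (*-comm b Sx)
    collect : ∀ Sx Sy S1 → Sy * Sx + Sx * Sy - 2ℚ * S1 * S1 ≡ 2ℚ * (Sx * Sy - S1 * S1)
    collect = solve-∀ ℚ-ring

  pairTerm-nonNeg : ∀ i j k l → E i j ≡ true → E k l ≡ true → 0ℚ ≤ pairTerm i j k l
  pairTerm-nonNeg i j k l Eij Ekl =
    *-nonNeg (0≤p*p (x i j - x k l)) (<⇒≤ (*-pos (y-pos i j Eij) (y-pos k l Ekl)))
    where
    y-pos : ∀ i j → E i j ≡ true → 0ℚ < y i j
    y-pos i j Eij = inv-pos (x-pos i j Eij)

  lagrange-nonNeg : 0ℚ ≤ sumOn E (λ i j → sumOn E (pairTerm i j))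
  lagrange-nonNeg = sumOn-nonNeg E (λ i j Eij → sumOn-nonNeg E (λ k l → pairTerm-nonNeg i j k l Eij))

  cauchy-schwarz : S1 * S1 ≤ Sx * Sy
  cauchy-schwarz = 0≤q-p⇒p≤q (0≤2p⇒0≤p (subst (0ℚ ≤_) lagrange lagrange-nonNeg))

  cauchy-schwarz-equality : Sx * Sy ≡ S1 * S1 ⇔ (∀ i j k l → E i j ≡ true → E k l ≡ true → x i j ≡ x k l)
  cauchy-schwarz-equality = mk⇔ constant equal
    where
    constant : Sx * Sy ≡ S1 * S1 → ∀ i j k l → E i j ≡ true → E k l ≡ true → x i j ≡ x k l
    constant eq i j k l Eij Ekl =
      Sum.[ from-square , (λ yy≡0 → ⊥-elim (yy≢0 yy≡0)) ] (p*q≡0⇒p≡0⊎q≡0 _ _ pairTerm≡0)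
      where
      lagrange≡0 : sumOn E (λ i j → sumOn E (pairTerm i j)) ≡ 0ℚ
      lagrange≡0 = trans lagrange (trans (cong (λ s → 2ℚ * (s - S1 * S1)) eq) (cong (2ℚ *_) (+-inverseʳ (S1 * S1))))
      inner≡0 : sumOn E (pairTerm i j) ≡ 0ℚ
      inner≡0 = nonNeg-sumOn≡0⇒≡0 E (λ i j Eij → sumOn-nonNeg E (λ k l → pairTerm-nonNeg i j k l Eij)) lagrange≡0 i j Eij
      pairTerm≡0 : pairTerm i j k l ≡ 0ℚ
      pairTerm≡0 = nonNeg-sumOn≡0⇒≡0 E (λ k l → pairTerm-nonNeg i j k l Eij) inner≡0 k l Ekl
      from-square : (x i j - x k l) * (x i j - x k l) ≡ 0ℚ → x i j ≡ x k l
      from-square square≡0 = p-q≡0⇒p≡q {x i j} {x k l} (p*p≡0⇒p≡0 (x i j - x k l) square≡0)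
      yy≢0 : y i j * y k l ≢ 0ℚ
      yy≢0 = pos⇒≢0 (*-pos (inv-pos (x-pos i j Eij)) (inv-pos (x-pos k l Ekl)))
    equal : (∀ i j k l → E i j ≡ true → E k l ≡ true → x i j ≡ x k l) → Sx * Sy ≡ S1 * S1
    equal const = p-q≡0⇒p≡q (2*-injective (begin
      2ℚ * (Sx * Sy - S1 * S1)                   ≡⟨ lagrange ⟨
      sumOn E (λ i j → sumOn E (pairTerm i j))   ≡⟨ sumOn-cong E (λ i j Eij → sumOn-cong E (pairTerm≡0 i j Eij)) ⟩
      sumOn E (λ i j → sumOn E (λ _ _ → 0ℚ))     ≡⟨ sumOn-cong E (λ _ _ _ → sumOn-zero E) ⟩
      sumOn E (λ _ _ → 0ℚ)                       ≡⟨ sumOn-zero E ⟩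
      0ℚ                                         ≡⟨ *-zeroʳ 2ℚ ⟨
      2ℚ * 0ℚ                                    ∎))
      where
      open ≡-Reasoning
      pairTerm≡0 : ∀ i j → E i j ≡ true → ∀ k l → E k l ≡ true → pairTerm i j k l ≡ 0ℚ
      pairTerm≡0 i j Eij k l Ekl = begin
        (x i j - x k l) * (x i j - x k l) * (y i j * y k l) ≡⟨ cong (λ d → d * d * (y i j * y k l)) (p≡q⇒p-q≡0 (const i j k l Eij Ekl)) ⟩
        0ℚ * 0ℚ * (y i j * y k l)                           ≡⟨ *-zeroˡ (y i j * y k l) ⟩
        0ℚ                                                  ∎

module EdgeSlack (N h : ℚ) (h*2≡N : h * 2ℚ ≡ N) where

  -- The share of an edge of resistance x in (n/2) μ - C, as μ = Σ_e (1 - x_e) by Foster's theorem.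
  slack : ℚ → ℚ
  slack x = h * (1ℚ - x) - (inv x - 1ℚ)

  2x*slack : ∀ {x} → 0ℚ < x → 2ℚ * x * slack x ≡ (1ℚ - x) * (N * x - 2ℚ)
  2x*slack {x} 0<x = begin
    2ℚ * x * (h * (1ℚ - x) - (inv x - 1ℚ))              ≡⟨ expand h x (inv x) ⟩
    (h * 2ℚ) * x * (1ℚ - x) - 2ℚ * (x * inv x) + 2ℚ * x ≡⟨ cong₂ (λ a b → a * x * (1ℚ - x) - 2ℚ * b + 2ℚ * x) h*2≡N x*x⁻¹≡1 ⟩
    N * x * (1ℚ - x) - 2ℚ * 1ℚ + 2ℚ * x                 ≡⟨ factor N x ⟩
    (1ℚ - x) * (N * x - 2ℚ)                             ∎
    where
    open ≡-Reasoning
    x*x⁻¹≡1 : x * inv x ≡ 1ℚ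
    x*x⁻¹≡1 = *-inv x (pos⇒≢0 0<x)
    expand : ∀ h x x⁻¹ → 2ℚ * x * (h * (1ℚ - x) - (x⁻¹ - 1ℚ)) ≡ (h * 2ℚ) * x * (1ℚ - x) - 2ℚ * (x * x⁻¹) + 2ℚ * x
    expand = solve-∀ ℚ-ring
    factor : ∀ N x → N * x * (1ℚ - x) - 2ℚ * 1ℚ + 2ℚ * x ≡ (1ℚ - x) * (N * x - 2ℚ)
    factor = solve-∀ ℚ-ring

  slack-nonNeg : ∀ {x} → 0ℚ < x → x ≤ 1ℚ → 2ℚ ≤ N * x → 0ℚ ≤ slack x
  slack-nonNeg {x} 0<x x≤1 2≤Nx = *-cancelˡ-≤-pos (2ℚ * x) {{positive 0<2x}}
    (subst₂ _≤_ (sym (*-zeroʳ (2ℚ * x))) (sym (2x*slack 0<x)) (*-nonNeg (p≤q⇒0≤q-p x≤1) (p≤q⇒0≤q-p 2≤Nx)))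
    where
    0<2x : 0ℚ < 2ℚ * x
    0<2x = *-pos (positive⁻¹ 2ℚ) 0<x

  slack≡0⇒product≡0 : ∀ {x} → 0ℚ < x → slack x ≡ 0ℚ → (1ℚ - x) * (N * x - 2ℚ) ≡ 0ℚ
  slack≡0⇒product≡0 {x} 0<x s≡0 = begin
    (1ℚ - x) * (N * x - 2ℚ) ≡⟨ 2x*slack 0<x ⟨
    2ℚ * x * slack x        ≡⟨ cong (_*_ (2ℚ * x)) s≡0 ⟩
    2ℚ * x * 0ℚ             ≡⟨ *-zeroʳ (2ℚ * x) ⟩
    0ℚ                      ∎
    where open ≡-Reasoning

  slack≡0⇔ : ∀ {x} → 0ℚ < x → slack x ≡ 0ℚ ⇔ (x ≡ 1ℚ ⊎ N * x ≡ 2ℚ)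
  slack≡0⇔ {x} 0<x = mk⇔ tight slack≡0
    where
    tight : slack x ≡ 0ℚ → x ≡ 1ℚ ⊎ N * x ≡ 2ℚ
    tight s≡0 = Sum.map (λ 1-x≡0 → sym (p-q≡0⇒p≡q {1ℚ} {x} 1-x≡0)) (p-q≡0⇒p≡q {N * x} {2ℚ})
                        (p*q≡0⇒p≡0⊎q≡0 (1ℚ - x) (N * x - 2ℚ) (slack≡0⇒product≡0 0<x s≡0))
    product≡0 : x ≡ 1ℚ ⊎ N * x ≡ 2ℚ → (1ℚ - x) * (N * x - 2ℚ) ≡ 0ℚ
    product≡0 (inj₁ x≡1)  = trans (cong (λ t → (1ℚ - t) * (N * x - 2ℚ)) x≡1)
                              (trans (cong (_* (N * x - 2ℚ)) (+-inverseʳ 1ℚ)) (*-zeroˡ (N * x - 2ℚ)))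
    product≡0 (inj₂ Nx≡2) = trans (cong (λ t → (1ℚ - x) * (t - 2ℚ)) Nx≡2)
                              (trans (cong (_*_ (1ℚ - x)) (+-inverseʳ 2ℚ)) (*-zeroʳ (1ℚ - x)))
    slack≡0 : x ≡ 1ℚ ⊎ N * x ≡ 2ℚ → slack x ≡ 0ℚ
    slack≡0 x≡1⊎Nx≡2 = *-cancelˡ-≡ {2ℚ * x} (pos⇒≢0 (*-pos (positive⁻¹ 2ℚ) 0<x))
      (trans (2x*slack 0<x) (trans (product≡0 x≡1⊎Nx≡2) (sym (*-zeroʳ (2ℚ * x)))))

-- The graph Laplacian and the maximum principle

module Laplacian {n} (G : Graph n) where

  adj⇒≢ : ∀ {i j} → adj G i j ≡ true → i ≢ j
  adj⇒≢ {i} aij refl with trans (sym aij) (irrefl G i)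
  ... | ()

  current : (Fin n → ℚ) → Fin n → Fin n → ℚ
  current v k l = if adj G k l then v k - v l else 0ℚ

  laplacian : (Fin n → ℚ) → Fin n → ℚ
  laplacian v k = sum (current v k)

  current-adj : ∀ v {k l} → adj G k l ≡ true → current v k l ≡ v k - v l
  current-adj v {k} {l} akl rewrite akl = refl

  current-nonadj : ∀ v {k l} → adj G k l ≡ false → current v k l ≡ 0ℚ
  current-nonadj v {k} {l} akl rewrite akl = refl

  laplacian-scale : ∀ c v k → laplacian (λ x → c * v x) k ≡ c * laplacian v k
  laplacian-scale c v k = trans (sum-cong-≗ pointwise) (sym (*-distribˡ-sum c (current v k)))
    where
    pointwise : ∀ l → current (λ x → c * v x) k l ≡ c * current v k l
    pointwise l with adj G k l
    ... | true  = sym (*-distribˡ-- c (v k) (v l))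
      where
      *-distribˡ-- : ∀ c p q → c * (p - q) ≡ c * p - c * q
      *-distribˡ-- = solve-∀ ℚ-ring
    ... | false = sym (*-zeroʳ c)

  laplacian-sub : ∀ v w k → laplacian (λ x → v x - w x) k ≡ laplacian v k - laplacian w k
  laplacian-sub v w k = trans (sum-cong-≗ pointwise) (∑-distrib-- (current v k) (current w k))
    where
    pointwise : ∀ l → current (λ x → v x - w x) k l ≡ current v k l - current w k l
    pointwise l with adj G k l
    ... | true  = regroup (v k) (w k) (v l) (w l)
      where
      regroup : ∀ a b c d → a - b - (c - d) ≡ a - c - (b - d)
      regroup = solve-∀ ℚ-ring
    ... | false = sym (+-inverseʳ 0ℚ)

  laplacian-sum : ∀ {m} (F : Fin m → Fin n → ℚ) k → laplacian (λ x → sum (λ b → F b x)) k ≡ sum (λ b → laplacian (F b) k)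
  laplacian-sum {m} F k = trans (sum-cong-≗ pointwise) (∑-comm (λ l b → current (F b) k l))
    where
    pointwise : ∀ l → current (λ x → sum (λ b → F b x)) k l ≡ sum (λ b → current (F b) k l)
    pointwise l with adj G k l
    ... | true  = sym (∑-distrib-- (λ b → F b k) (λ b → F b l))
    ... | false = sym (sum-replicate-zero m)

  laplacian-neg : ∀ v k → laplacian (λ x → - v x) k ≡ - laplacian v k
  laplacian-neg v k = trans (sum-cong-≗ pointwise) (∑-neg (current v k))
    where
    pointwise : ∀ l → current (λ x → - v x) k l ≡ - current v k l
    pointwise l with adj G k l
    ... | true  = neg-sub (v k) (v l)
      where
      neg-sub : ∀ p q → - p - - q ≡ - (p - q)
      neg-sub = solve-∀ ℚ-ring
    ... | false = refl

  current-nonNeg-at-max : ∀ v {a} → (∀ l → v l ≤ v a) → ∀ l → 0ℚ ≤ current v a l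
  current-nonNeg-at-max v {a} max l with adj G a l
  ... | true  = p≤q⇒0≤q-p (max l)
  ... | false = ≤-refl

  max-spreads : ∀ v {a} → (∀ l → v l ≤ v a) → laplacian v a ≤ 0ℚ → ∀ {l} → adj G a l ≡ true → v l ≡ v a
  max-spreads v {a} max Lv≤0 {l} al =
    sym (p-q≡0⇒p≡q (trans (sym (current-adj v al)) (nonNeg-sum≤0⇒≡0 (current-nonNeg-at-max v max) Lv≤0 l)))

  maximum-principle : Connected G → ∀ w a → (∀ k → k ≢ a → laplacian w k ≤ 0ℚ) → ∀ l → w l ≤ w a
  maximum-principle connected w a subharmonic l = subst (w l ≤_) (sym wa≡wm) (max l)
    where
    m : Fin n
    m = proj₁ (argmax w a)
    max : ∀ l → w l ≤ w m
    max = proj₂ (argmax w a)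
    maximal : ∀ {t} → Reach G m t → w t ≡ w m ⊎ w a ≡ w m
    maximal here = inj₁ refl
    maximal (step {s} r ast) with maximal r
    ... | inj₂ wa≡wm = inj₂ wa≡wm
    ... | inj₁ ws≡wm with s ≟ᶠ a
    ...   | yes refl = inj₂ ws≡wm
    ...   | no  s≢a  = inj₁ (trans (max-spreads w (λ l → subst (w l ≤_) (sym ws≡wm) (max l)) (subharmonic s s≢a) ast) ws≡wm)
    wa≡wm : w a ≡ w m
    wa≡wm = Sum.reduce (maximal (connected m a))

  harmonic⇒constant : Connected G → ∀ h → (∀ k → laplacian h k ≡ 0ℚ) → ∀ a b → h a ≡ h b
  harmonic⇒constant connected h harmonic a b =
    ≤-antisym (maximum-principle connected h b (λ k _ → ≤-reflexive (harmonic k)) a)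
              (maximum-principle connected h a (λ k _ → ≤-reflexive (harmonic k)) b)

  pos-current⇒descent : ∀ v {k l} → 0ℚ < current v k l → adj G k l ≡ true × v l < v k
  pos-current⇒descent v {k} {l} 0<current with adj G k l
  ... | true  = refl , 0<q-p⇒p<q 0<current
  ... | false = ⊥-elim (<-irrefl refl 0<current)

  drop : (Fin n → ℚ) → Fin n → ℚ
  drop v a = sum (λ l → v a - v l)

  current≤drop : ∀ v {a} → (∀ l → v l ≤ v a) → ∀ l → current v a l ≤ v a - v l
  current≤drop v {a} max l with adj G a l
  ... | true  = ≤-refl
  ... | false = p≤q⇒0≤q-p (max l)

  laplacian≤drop : ∀ v {a} → (∀ l → v l ≤ v a) → laplacian v a ≤ drop v a
  laplacian≤drop v max = sum-mono-≤ (current≤drop v max)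

  laplacian≡drop⇒max-off-neighbours : ∀ v {a} → (∀ l → v l ≤ v a) → laplacian v a ≡ drop v a →
                                      ∀ {l} → adj G a l ≡ false → v l ≡ v a
  laplacian≡drop⇒max-off-neighbours v {a} max L≡drop {l} a≁l = sym (p-q≡0⇒p≡q (begin
    v a - v l                      ≡⟨ +-identityʳ (v a - v l) ⟨
    v a - v l - 0ℚ                 ≡⟨ cong (_-_ (v a - v l)) (current-nonadj v a≁l) ⟨
    v a - v l - current v a l      ≡⟨ nonNeg-sum≤0⇒≡0 gap-nonNeg (≤-reflexive gap-sum≡0) l ⟩
    0ℚ                             ∎))
    where
    open ≡-Reasoning
    gap-nonNeg : ∀ l → 0ℚ ≤ v a - v l - current v a l
    gap-nonNeg l = p≤q⇒0≤q-p (current≤drop v max l)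
    gap-sum≡0 : sum (λ l → v a - v l - current v a l) ≡ 0ℚ
    gap-sum≡0 = trans (∑-distrib-- (λ l → v a - v l) (current v a)) (trans (cong (_-_ (drop v a)) L≡drop) (+-inverseʳ (drop v a)))

module Resistance {n} (G : Graph n) (connected : Connected G)
                  (Ω : Fin n → Fin n → ℚ) (isΩ : IsResistanceDistance G Ω) where

  open Laplacian G

  potential : Fin n → Fin n → Fin n → ℚ
  potential i j = proj₁ (isΩ i j)

  laplacian-potential : ∀ i j k → laplacian (potential i j) k ≡ δ i k - δ j k
  laplacian-potential i j k = trans (sym (sumV≡sum (current (potential i j) k))) (proj₁ (proj₂ (isΩ i j)) k)

  Ω≡potential-drop : ∀ i j → Ω i j ≡ potential i j i - potential i j j
  Ω≡potential-drop i j = proj₂ (proj₂ (isΩ i j))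

  -- Two solutions of Kirchhoff's equations differ by a harmonic, hence constant, function.
  Ω-unique : ∀ i j w → (∀ k → laplacian w k ≡ δ i k - δ j k) → Ω i j ≡ w i - w j
  Ω-unique i j w Lw = trans (Ω≡potential-drop i j) (shift (harmonic⇒constant connected d harmonic i j))
    where
    v : Fin n → ℚ
    v = potential i j
    d : Fin n → ℚ
    d x = v x - w x
    harmonic : ∀ k → laplacian d k ≡ 0ℚ
    harmonic k = trans (laplacian-sub v w k) (trans (cong₂ _-_ (laplacian-potential i j k) (Lw k)) (+-inverseʳ (δ i k - δ j k)))
    shift : v i - w i ≡ v j - w j → v i - v j ≡ w i - w j
    shift e = trans (regroup (v i) (w i) (v j) (w j)) (trans (cong (λ t → t - (v j - w j) + (w i - w j)) e) (cancel (v j - w j) (w i - w j)))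
      where
      regroup : ∀ a b c d → a - c ≡ (a - b) - (c - d) + (b - d)
      regroup = solve-∀ ℚ-ring
      cancel : ∀ c d → c - c + d ≡ d
      cancel = solve-∀ ℚ-ring

  module Edge {i j} (i∼j : adj G i j ≡ true) where

    v w : Fin n → ℚ
    v = potential i j
    w x = - v x

    i≢j : i ≢ j
    i≢j = adj⇒≢ i∼j

    laplacian-v : ∀ k → laplacian v k ≡ δ i k - δ j k
    laplacian-v = laplacian-potential i j

    laplacian-w : ∀ k → laplacian w k ≡ δ j k - δ i k
    laplacian-w k = trans (laplacian-neg v k) (trans (cong -_ (laplacian-v k)) (neg-sub (δ i k) (δ j k)))
      where
      neg-sub : ∀ p q → - (p - q) ≡ q - p
      neg-sub = solve-∀ ℚ-ring

    laplacian-v-source : laplacian v i ≡ 1ℚ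
    laplacian-v-source = trans (laplacian-v i) (cong₂ _-_ (δ-diag i) (δ-off i≢j))

    laplacian-w-sink : laplacian w j ≡ 1ℚ
    laplacian-w-sink = trans (laplacian-w j) (cong₂ _-_ (δ-diag j) (δ-off (i≢j ∘ sym)))

    laplacian-v-interior : ∀ {k} → k ≢ i → k ≢ j → laplacian v k ≡ 0ℚ
    laplacian-v-interior k≢i k≢j = trans (laplacian-v _) (cong₂ _-_ (δ-off k≢i) (δ-off k≢j))

    v-subharmonic : ∀ k → k ≢ i → laplacian v k ≤ 0ℚ
    v-subharmonic k k≢i = subst (_≤ 0ℚ) (sym (trans (laplacian-v k) (trans (cong (_- δ j k) (δ-off k≢i)) (+-identityˡ (- δ j k)))))
                            (neg-antimono-≤ (δ-nonNeg j k))

    w-subharmonic : ∀ k → k ≢ j → laplacian w k ≤ 0ℚ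
    w-subharmonic k k≢j = subst (_≤ 0ℚ) (sym (trans (laplacian-w k) (trans (cong (_- δ i k) (δ-off k≢j)) (+-identityˡ (- δ i k)))))
                            (neg-antimono-≤ (δ-nonNeg i k))

    v-max : ∀ l → v l ≤ v i
    v-max = maximum-principle connected v i v-subharmonic

    w-max : ∀ l → w l ≤ w j
    w-max = maximum-principle connected w j w-subharmonic

    Ω≡vi-vj : Ω i j ≡ v i - v j
    Ω≡vi-vj = Ω≡potential-drop i j

    current≡Ω : current v i j ≡ Ω i j
    current≡Ω = trans (current-adj v i∼j) (sym Ω≡vi-vj)

    Ω≤1 : Ω i j ≤ 1ℚ
    Ω≤1 = subst₂ _≤_ current≡Ω laplacian-v-source (term≤sum (current-nonNeg-at-max v v-max) j)

    -- For every l, v i - v j = (v i - v l) + (w j - w l); sum over l.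
    drop-v+drop-w : drop v i + drop w j ≡ fromℕ n * Ω i j
    drop-v+drop-w = begin
      sum (λ l → v i - v l) + sum (λ l → w j - w l) ≡⟨ ∑-distrib-+ (λ l → v i - v l) (λ l → w j - w l) ⟨
      sum (λ l → v i - v l + (w j - w l))            ≡⟨ sum-cong-≗ (λ l → telescope (v i) (v l) (v j)) ⟩
      sum {n} (λ _ → v i - v j)                      ≡⟨ sum-const n (v i - v j) ⟩
      fromℕ n * (v i - v j)                          ≡⟨ cong (fromℕ n *_) Ω≡vi-vj ⟨
      fromℕ n * Ω i j                                ∎
      where
      open ≡-Reasoning
      telescope : ∀ a b c → a - b + (- c - - b) ≡ a - c
      telescope = solve-∀ ℚ-ring

    1≤drop-v : 1ℚ ≤ drop v i
    1≤drop-v = subst (_≤ drop v i) laplacian-v-source (laplacian≤drop v v-max)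

    1≤drop-w : 1ℚ ≤ drop w j
    1≤drop-w = subst (_≤ drop w j) laplacian-w-sink (laplacian≤drop w w-max)

    2≤nΩ : 2ℚ ≤ fromℕ n * Ω i j
    2≤nΩ = subst (2ℚ ≤_) drop-v+drop-w (+-mono-≤ 1≤drop-v 1≤drop-w)

    Ω-pos : 0ℚ < Ω i j
    Ω-pos = ≤∧≢⇒< 0≤Ω Ω≢0
      where
      0≤Ω : 0ℚ ≤ Ω i j
      0≤Ω = subst (0ℚ ≤_) (sym Ω≡vi-vj) (p≤q⇒0≤q-p (neg-cancel-≤ (w-max i)))
      Ω≢0 : 0ℚ ≢ Ω i j
      Ω≢0 0≡Ω = <-irrefl refl (<-≤-trans (positive⁻¹ 2ℚ) (subst (2ℚ ≤_) nΩ≡0 2≤nΩ))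
        where
        nΩ≡0 : fromℕ n * Ω i j ≡ 0ℚ
        nΩ≡0 = trans (cong (fromℕ n *_) (sym 0≡Ω)) (*-zeroʳ (fromℕ n))

    v-source≢v-sink : v i ≢ v j
    v-source≢v-sink vi≡vj = <-irrefl (sym (trans Ω≡vi-vj (trans (cong (_- v j) vi≡vj) (+-inverseʳ (v j))))) Ω-pos

    v-spreads : ∀ {t} → t ≢ i → v t ≡ v i → ∀ {s} → adj G t s ≡ true → v s ≡ v i
    v-spreads t≢i vt≡vi t∼s = trans (max-spreads v (λ l → subst (v l ≤_) (sym vt≡vi) (v-max l)) (v-subharmonic _ t≢i) t∼s) vt≡vi

    w-spreads : ∀ {t} → t ≢ j → w t ≡ w j → ∀ {s} → adj G t s ≡ true → w s ≡ w j
    w-spreads t≢j wt≡wj t∼s = trans (max-spreads w (λ l → subst (w l ≤_) (sym wt≡wj) (w-max l)) (w-subharmonic _ t≢j) t∼s) wt≡wj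

    Ω≡1⇒v-const-on-neighbours : Ω i j ≡ 1ℚ → ∀ {l} → adj G i l ≡ true → l ≢ j → v l ≡ v i
    Ω≡1⇒v-const-on-neighbours Ω≡1 {l} i∼l l≢j =
      sym (p-q≡0⇒p≡q {v i} {v l} (trans (sym (current-adj v i∼l))
        (nonNeg-sum≤term⇒others≡0 (current-nonNeg-at-max v v-max) laplacian≤current l≢j)))
      where
      laplacian≤current : laplacian v i ≤ current v i j
      laplacian≤current = ≤-reflexive (trans laplacian-v-source (sym (trans current≡Ω Ω≡1)))

    nΩ≡2⇒laplacian≡drop : fromℕ n * Ω i j ≡ 2ℚ → laplacian v i ≡ drop v i × laplacian w j ≡ drop w j
    nΩ≡2⇒laplacian≡drop nΩ≡2 = tight laplacian-v-source a≡0 , tight laplacian-w-sink b≡0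
      where
      a b : ℚ
      a = drop v i - 1ℚ
      b = drop w j - 1ℚ
      a+b≡0 : a + b ≡ 0ℚ
      a+b≡0 = trans (regroup (drop v i) (drop w j)) (trans (cong (_- 2ℚ) (trans drop-v+drop-w nΩ≡2)) (+-inverseʳ 2ℚ))
        where
        regroup : ∀ p q → p - 1ℚ + (q - 1ℚ) ≡ p + q - 2ℚ
        regroup = solve-∀ ℚ-ring
      a≡0 : a ≡ 0ℚ
      a≡0 = nonNeg+nonNeg≡0⇒≡0 (p≤q⇒0≤q-p 1≤drop-v) (p≤q⇒0≤q-p 1≤drop-w) a+b≡0
      b≡0 : b ≡ 0ℚ
      b≡0 = nonNeg+nonNeg≡0⇒≡0 (p≤q⇒0≤q-p 1≤drop-w) (p≤q⇒0≤q-p 1≤drop-v) (trans (+-comm b a) a+b≡0)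
      tight : ∀ {L d} → L ≡ 1ℚ → d - 1ℚ ≡ 0ℚ → L ≡ d
      tight {L} {d} L≡1 d-1≡0 = trans L≡1 (sym (p-q≡0⇒p≡q {d} {1ℚ} d-1≡0))

    -- If n Ω = 2, every vertex l ≠ j lies next to j: otherwise l would share the minimal potential of j,
    -- and so would all its neighbours, while i is either one of them or attains the maximal potential too.
    nΩ≡2⇒sink-universal : fromℕ n * Ω i j ≡ 2ℚ → ∀ l → l ≢ j → adj G j l ≡ true
    nΩ≡2⇒sink-universal nΩ≡2 l l≢j with adj G j l in j∼l
    ... | true  = refl
    ... | false = ⊥-elim (v-source≢v-sink (i-case (adj G i l) refl))
      where
      tight : laplacian v i ≡ drop v i × laplacian w j ≡ drop w j
      tight = nΩ≡2⇒laplacian≡drop nΩ≡2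
      wl≡wj : w l ≡ w j
      wl≡wj = laplacian≡drop⇒max-off-neighbours w w-max (proj₂ tight) j∼l
      i-case : ∀ b → adj G i l ≡ b → v i ≡ v j
      i-case true  i∼l = neg-injective (w-spreads l≢j wl≡wj (trans (Graph.sym G l i) i∼l))
      i-case false i≁l = trans (sym (laplacian≡drop⇒max-off-neighbours v v-max (proj₁ tight) i≁l)) (neg-injective wl≡wj)

  all-Ω≡1⇒acyclic : (∀ i j → adj G i j ≡ true → Ω i j ≡ 1ℚ) → Acyclic G
  all-Ω≡1⇒acyclic Ω≡1 []                  ()
  all-Ω≡1⇒acyclic Ω≡1 (_ ∷ [])            (() , _)
  all-Ω≡1⇒acyclic Ω≡1 (_ ∷ _ ∷ [])        (ℕ.s≤s () , _)
  all-Ω≡1⇒acyclic Ω≡1 (x₀ ∷ x₁ ∷ r ∷ rs)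
    (_ , ((_ ∷ x₀∉) ∷ (x₁∉ ∷ _)) , cons _ _ _ x₀∼x₁ path , last∼x₀) =
    v-source≢v-sink (sym (back x₁ (r ∷ rs) path (All.map (_∘ sym) x₀∉) v-last))
    where
    open Edge x₀∼x₁
    -- The last vertex of the cycle is a neighbour of x₀ other than x₁, so it has potential v x₀,
    -- which then spreads backwards along the cycle to x₁.
    v-last : v (last r rs) ≡ v x₀
    v-last = Ω≡1⇒v-const-on-neighbours (Ω≡1 x₀ x₁ x₀∼x₁) (trans (Graph.sym G x₀ _) last∼x₀) (All-last x₁∉ ∘ sym)
    back : ∀ z zs → Path G (z ∷ zs) → All (_≢ x₀) zs → v (last z zs) ≡ v x₀ → v z ≡ v x₀
    back z []        _                   _              v-end = v-end
    back z (z′ ∷ zs) (cons _ _ _ z∼z′ p) (z′≢x₀ ∷ zs∉) v-end =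
      v-spreads z′≢x₀ (back z′ zs p zs∉ v-end) (trans (Graph.sym G z′ z) z∼z′)

  module Descent {i j} (i∼j : adj G i j ≡ true) where
    open Edge i∼j

    DescendingPath : Fin n → Set
    DescendingPath t = ∃ λ ws → Path G (t ∷ ws) × last t ws ≡ j × Unique (t ∷ ws) × All (λ x → v x < v t) ws

    -- Away from i and j the current is conserved, so entering t from a higher neighbour p forces
    -- a lower neighbour q; the number of vertices below the current potential bounds the length.
    descend : ∀ fuel t {p} → countBelow v (v t) ℕ.< fuel → adj G p t ≡ true → v t < v p → v t < v i → DescendingPath t
    descend zero       t bound _   _       _       = ⊥-elim (ℕₚ.n≮0 bound)
    descend (suc fuel) t {p} bound p∼t vt<vp vt<vi with t ≟ᶠ j
    ... | yes refl = [] , one t , refl , [] ∷ [] , []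
    ... | no  t≢j  with pos-sum-except⇒pos-term (current v t) p inflow
      where
      t≢i : t ≢ i
      t≢i refl = <-irrefl refl vt<vi
      inflow : 0ℚ < laplacian v t - current v t p
      inflow = subst (0ℚ <_) (sym (trans (cong₂ _-_ (laplacian-v-interior t≢i t≢j) (current-adj v (trans (Graph.sym G t p) p∼t)))
                                          (+-identityˡ (- (v t - v p)))))
                 (neg-antimono-< (p<q⇒p-q<0 vt<vp))
    ... | q , _ , 0<current with pos-current⇒descent v 0<current
    ...   | t∼q , vq<vt with descend fuel q (ℕₚ.<-≤-trans (countBelow-< v vq<vt) (ℕₚ.≤-pred bound)) t∼q vq<vt (<-trans vq<vt vt<vi)
    ...     | ws , path , ends , unique , below =
      q ∷ ws , cons t q ws t∼q path , ends , All.map (λ x<t t≡x → <-irrefl (cong v (sym t≡x)) x<t) below′ ∷ unique , below′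
      where
      below′ : All (λ x → v x < v t) (q ∷ ws)
      below′ = vq<vt ∷ All.map (λ x<q → <-trans x<q vq<vt) below

    -- If Ω i j < 1, some current leaves i along an edge other than ij; following it downhill reaches j,
    -- closing a cycle through the edge ij.
    acyclic⇒Ω≡1 : Acyclic G → Ω i j ≡ 1ℚ
    acyclic⇒Ω≡1 acyclic with Ω i j ≟ 1ℚ
    ... | yes Ω≡1 = Ω≡1
    ... | no  Ω≢1 with pos-sum-except⇒pos-term (current v i) j outflow
      where
      outflow : 0ℚ < laplacian v i - current v i j
      outflow = subst (0ℚ <_) (sym (cong₂ _-_ laplacian-v-source current≡Ω)) (p<q⇒0<q-p (≤∧≢⇒< Ω≤1 Ω≢1))
    ... | l , l≢j , 0<current with pos-current⇒descent v 0<current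
    ...   | i∼l , vl<vi with descend (suc (countBelow v (v l))) l (ℕₚ.n<1+n _) i∼l vl<vi vl<vi
    ...     | ws , path , ends , unique , below = ⊥-elim (acyclic (i ∷ l ∷ ws) (long ws ends , i∉ ∷ unique , cons i l ws i∼l path , closes))
      where
      long : ∀ zs → last l zs ≡ j → 2 ℕ.≤ length (l ∷ zs)
      long []      l≡j = ⊥-elim (l≢j l≡j)
      long (_ ∷ _) _   = ℕ.s≤s (ℕ.s≤s ℕ.z≤n)
      i∉ : All (i ≢_) (l ∷ ws)
      i∉ = All.map (λ x<i i≡x → <-irrefl (cong v (sym i≡x)) x<i) (vl<vi ∷ All.map (λ x<l → <-trans x<l vl<vi) below)
      closes : adj G (last l ws) i ≡ true
      closes = subst (λ z → adj G z i ≡ true) (sym ends) (trans (Graph.sym G j i) i∼j)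

  module _ ⦃ _ : ℕ.NonZero n ⦄ where

    1/n : ℚ
    1/n = inv (fromℕ n)

    n*1/n≡1 : fromℕ n * 1/n ≡ 1ℚ
    n*1/n≡1 = *-inv (fromℕ n) (pos⇒≢0 (fromℕ-pos n))

    -- The potential of a unit current entering at a and leaving through every vertex in equal parts.
    φ : Fin n → Fin n → ℚ
    φ a x = 1/n * sum (λ b → potential a b x)

    laplacian-φ : ∀ a k → laplacian (φ a) k ≡ δ a k - 1/n
    laplacian-φ a k = begin
      laplacian (φ a) k                                     ≡⟨ laplacian-scale 1/n (λ x → sum (λ b → potential a b x)) k ⟩
      1/n * laplacian (λ x → sum (λ b → potential a b x)) k ≡⟨ cong (1/n *_) (laplacian-sum (potential a) k) ⟩
      1/n * sum (λ b → laplacian (potential a b) k)         ≡⟨ cong (1/n *_) (sum-cong-≗ (λ b → laplacian-potential a b k)) ⟩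
      1/n * sum (λ b → δ a k - δ b k)                       ≡⟨ cong (1/n *_) (∑-distrib-- (λ _ → δ a k) (λ b → δ b k)) ⟩
      1/n * (sum {n} (λ _ → δ a k) - sum (λ b → δ b k))     ≡⟨ cong₂ (λ p q → 1/n * (p - q)) (sum-const n (δ a k)) column ⟩
      1/n * (fromℕ n * δ a k - 1ℚ)                          ≡⟨ regroup 1/n (fromℕ n) (δ a k) ⟩
      (fromℕ n * 1/n) * δ a k - 1/n                         ≡⟨ cong (λ t → t * δ a k - 1/n) n*1/n≡1 ⟩
      1ℚ * δ a k - 1/n                                      ≡⟨ cong (_- 1/n) (*-identityˡ (δ a k)) ⟩
      δ a k - 1/n                                           ∎
      where
      open ≡-Reasoning
      column : sum (λ b → δ b k) ≡ 1ℚ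
      column = trans (sum-cong-≗ (λ b → δ-comm b k)) (sum-δ k)
      regroup : ∀ c m d → c * (m * d - 1ℚ) ≡ (m * c) * d - c
      regroup = solve-∀ ℚ-ring

    Ω≡φ : ∀ i j → Ω i j ≡ (φ i i - φ j i) - (φ i j - φ j j)
    Ω≡φ i j = Ω-unique i j (λ x → φ i x - φ j x) λ k →
      trans (laplacian-sub (φ i) (φ j) k) (trans (cong₂ _-_ (laplacian-φ i k) (laplacian-φ j k))
        (cancel (δ i k) (δ j k) 1/n))
      where
      cancel : ∀ a b c → a - c - (b - c) ≡ a - b
      cancel = solve-∀ ℚ-ring

    Ω-sym : ∀ i j → Ω i j ≡ Ω j i
    Ω-sym i j = trans (Ω≡φ i j) (trans (swap (φ i i) (φ j i) (φ i j) (φ j j)) (sym (Ω≡φ j i)))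
      where
      swap : ∀ a b c d → a - b - (c - d) ≡ d - c - (b - a)
      swap = solve-∀ ℚ-ring

    -- Ω i j splits into the currents of φ i and φ j leaving their sources along the edge, so summing over
    -- all edges collects the Laplacians of the φ a at a.
    foster : sumOn (adj G) Ω ≡ 2ℚ * (fromℕ n - 1ℚ)
    foster = begin
      sum₂ (restrict (adj G) Ω)                   ≡⟨ sum₂-cong split ⟩
      sum₂ (λ i j → out i j + out j i)            ≡⟨ ∑₂-distrib-+ out (λ i j → out j i) ⟩
      sum₂ out + sum₂ (λ i j → out j i)           ≡⟨ cong (_+_ (sum₂ out)) (sum₂-transpose out) ⟩
      sum₂ out + sum₂ out                         ≡⟨ cong₂ _+_ diagonal diagonal ⟩
      fromℕ n * (1ℚ - 1/n) + fromℕ n * (1ℚ - 1/n) ≡⟨ regroup (fromℕ n) 1/n ⟩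
      2ℚ * (fromℕ n - fromℕ n * 1/n)              ≡⟨ cong (λ t → 2ℚ * (fromℕ n - t)) n*1/n≡1 ⟩
      2ℚ * (fromℕ n - 1ℚ)                         ∎
      where
      open ≡-Reasoning
      out : Fin n → Fin n → ℚ
      out i j = current (φ i) i j
      split : ∀ i j → restrict (adj G) Ω i j ≡ out i j + out j i
      split i j with adj G i j in i∼j
      ... | false rewrite trans (Graph.sym G j i) i∼j = refl
      ... | true  rewrite trans (Graph.sym G j i) i∼j =
        trans (Ω≡φ i j) (regroup′ (φ i i) (φ j i) (φ i j) (φ j j))
        where
        regroup′ : ∀ a b c d → a - b - (c - d) ≡ a - c + (d - b)
        regroup′ = solve-∀ ℚ-ring
      diagonal : sum (λ i → laplacian (φ i) i) ≡ fromℕ n * (1ℚ - 1/n)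
      diagonal = trans (sum-cong-≗ (λ i → trans (laplacian-φ i i) (cong (_- 1/n) (δ-diag i)))) (sum-const n (1ℚ - 1/n))
      regroup : ∀ m c → m * (1ℚ - c) + m * (1ℚ - c) ≡ 2ℚ * (m - m * c)
      regroup = solve-∀ ℚ-ring

    complete⇒nΩ≡2 : IsComplete G → ∀ {i j} → adj G i j ≡ true → fromℕ n * Ω i j ≡ 2ℚ
    complete⇒nΩ≡2 complete {i} {j} i∼j = trans (cong (fromℕ n *_) (Ω-unique i j u laplacian-u)) nu-drop
      where
      open ≡-Reasoning
      u : Fin n → ℚ
      u x = 1/n * (δ i x - δ j x)
      current-u : ∀ k l → current u k l ≡ u k - u l
      current-u k l with adj G k l in k∼l
      ... | true  = refl
      ... | false with k ≟ᶠ l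
      ...   | yes refl = sym (+-inverseʳ (u k))
      ...   | no  k≢l  with trans (sym k∼l) (complete k l k≢l)
      ...     | ()
      laplacian-u : ∀ k → laplacian u k ≡ δ i k - δ j k
      laplacian-u k = begin
        laplacian u k                              ≡⟨ sum-cong-≗ (current-u k) ⟩
        sum (λ l → u k - u l)                      ≡⟨ ∑-distrib-- (λ _ → u k) u ⟩
        sum {n} (λ _ → u k) - sum u                ≡⟨ cong₂ _-_ (sum-const n (u k)) (sym (*-distribˡ-sum 1/n (λ x → δ i x - δ j x))) ⟩
        fromℕ n * u k - 1/n * sum (λ x → δ i x - δ j x) ≡⟨ cong (λ t → fromℕ n * u k - 1/n * t) sum≡0 ⟩
        fromℕ n * u k - 1/n * (1ℚ - 1ℚ)            ≡⟨ regroup (fromℕ n) 1/n (δ i k) (δ j k) ⟩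
        (fromℕ n * 1/n) * (δ i k - δ j k)          ≡⟨ cong (_* (δ i k - δ j k)) n*1/n≡1 ⟩
        1ℚ * (δ i k - δ j k)                       ≡⟨ *-identityˡ (δ i k - δ j k) ⟩
        δ i k - δ j k                              ∎
        where
        sum≡0 : sum (λ x → δ i x - δ j x) ≡ 1ℚ - 1ℚ
        sum≡0 = trans (∑-distrib-- (δ i) (δ j)) (cong₂ _-_ (sum-δ i) (sum-δ j))
        regroup : ∀ m c p q → m * (c * (p - q)) - c * (1ℚ - 1ℚ) ≡ (m * c) * (p - q)
        regroup = solve-∀ ℚ-ring
      nu-drop : fromℕ n * (u i - u j) ≡ 2ℚ
      nu-drop = begin
        fromℕ n * (1/n * (δ i i - δ j i) - 1/n * (δ i j - δ j j))
          ≡⟨ cong₂ (λ p q → fromℕ n * (1/n * p - 1/n * q))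
                   (cong₂ _-_ (δ-diag i) (δ-off i≢j)) (cong₂ _-_ (δ-off (i≢j ∘ sym)) (δ-diag j)) ⟩
        fromℕ n * (1/n * (1ℚ - 0ℚ) - 1/n * (0ℚ - 1ℚ)) ≡⟨ regroup (fromℕ n) 1/n ⟩
        (fromℕ n * 1/n) * 2ℚ                         ≡⟨ cong (_* 2ℚ) n*1/n≡1 ⟩
        1ℚ * 2ℚ                                      ≡⟨ *-identityˡ 2ℚ ⟩
        2ℚ                                           ∎
        where
        i≢j : i ≢ j
        i≢j = adj⇒≢ i∼j
        regroup : ∀ m c → m * (c * (1ℚ - 0ℚ) - c * (0ℚ - 1ℚ)) ≡ (m * c) * 2ℚ
        regroup = solve-∀ ℚ-ring

    -- Both ends of an edge with n Ω = 2 are adjacent to every vertex; an edge ib with Ω = 1 would give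
    -- j (a neighbour of i) and then its neighbour b the potential of i, so every b is such an end.
    tight-edge⇒complete : (∀ {i j} → adj G i j ≡ true → Ω i j ≡ 1ℚ ⊎ fromℕ n * Ω i j ≡ 2ℚ) →
                          ∀ {i j} → adj G i j ≡ true → Ω i j ≢ 1ℚ → IsComplete G
    tight-edge⇒complete tight {i} {j} i∼j Ωij≢1 = complete
      where
      nΩ≡2 : ∀ {a b} (a∼b : adj G a b ≡ true) → Ω a b ≢ 1ℚ → fromℕ n * Ω a b ≡ 2ℚ
      nΩ≡2 a∼b Ω≢1 = Sum.[ ⊥-elim ∘ Ω≢1 , id ] (tight a∼b)
      j-universal : ∀ l → l ≢ j → adj G j l ≡ true
      j-universal = Edge.nΩ≡2⇒sink-universal i∼j (nΩ≡2 i∼j Ωij≢1)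
      i-universal : ∀ l → l ≢ i → adj G i l ≡ true
      i-universal = Edge.nΩ≡2⇒sink-universal (trans (Graph.sym G j i) i∼j) (trans (cong (fromℕ n *_) (Ω-sym j i)) (nΩ≡2 i∼j Ωij≢1))
      Ωib≢1 : ∀ {b} (i∼b : adj G i b ≡ true) → Ω i b ≢ 1ℚ
      Ωib≢1 {b} i∼b Ωib≡1 with b ≟ᶠ j
      ... | yes refl = Ωij≢1 Ωib≡1
      ... | no  b≢j  = Edge.v-source≢v-sink i∼b (sym (Edge.v-spreads i∼b (adj⇒≢ i∼j ∘ sym) vj≡vi (j-universal b b≢j)))
        where
        vj≡vi : Edge.v i∼b j ≡ Edge.v i∼b i
        vj≡vi = Edge.Ω≡1⇒v-const-on-neighbours i∼b Ωib≡1 i∼j (b≢j ∘ sym)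
      complete : IsComplete G
      complete x y x≢y with x ≟ᶠ i
      ... | yes refl = i-universal y (x≢y ∘ sym)
      ... | no  x≢i  = Edge.nΩ≡2⇒sink-universal i∼x (nΩ≡2 i∼x (Ωib≢1 i∼x)) y (x≢y ∘ sym)
        where
        i∼x : adj G i x ≡ true
        i∼x = i-universal x x≢i

module Bounds (k : ℕ) (G : Graph (suc (suc k))) (Ω : Fin (suc (suc k)) → Fin (suc (suc k)) → ℚ)
              (connected : Connected G) (isΩ : IsResistanceDistance G Ω) where

  open Laplacian G
  open Resistance G connected Ω isΩ

  N K M Σ1/Ω C μ : ℚ
  N = fromℕ (suc (suc k))
  K = fromℕ (suc k)
  M = fromℕ (numEdges G)
  Σ1/Ω = edgeSum G (λ i j → inv (Ω i j))
  C = cyclicity G Ω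
  μ = cyclomatic G

  μ≡M-K : μ ≡ M - K
  μ≡M-K = trans (cong (λ t → M - t + 1ℚ) (fromℕ-suc (suc k))) (regroup M K)
    where
    regroup : ∀ M K → M - (1ℚ + K) + 1ℚ ≡ M - K
    regroup = solve-∀ ℚ-ring

  Ω-pos : ∀ i j → adj G i j ≡ true → 0ℚ < Ω i j
  Ω-pos i j i∼j = Edge.Ω-pos i∼j

  open CauchySchwarz (adj G) Ω Ω-pos using (Sx; Sy; S1; cauchy-schwarz; cauchy-schwarz-equality)

  sumOn-Ω : sumOn (adj G) Ω ≡ 2ℚ * K
  sumOn-Ω = trans foster (cong (2ℚ *_) (trans (cong (_- 1ℚ) (fromℕ-suc (suc k))) (cancel K)))
    where
    cancel : ∀ K → 1ℚ + K - 1ℚ ≡ K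
    cancel = solve-∀ ℚ-ring

  sumOn-1/Ω : sumOn (adj G) (λ i j → inv (Ω i j)) ≡ 2ℚ * Σ1/Ω
  sumOn-1/Ω = sym (2*edgeSum≡sumOn G (λ i j → inv (Ω i j)) (λ i j → cong inv (Ω-sym i j)))

  sumOn-1 : sumOn (adj G) (λ _ _ → 1ℚ) ≡ 2ℚ * M
  sumOn-1 = sym (trans (cong (2ℚ *_) (fromℕ-numEdges G)) (2*edgeSum≡sumOn G (λ _ _ → 1ℚ) (λ _ _ → refl)))

  q : ℚ
  q = + numEdges G / suc k

  gap : ℚ
  gap = K * Σ1/Ω - M * M

  cauchy-schwarz-gap : Sx * Sy - S1 * S1 ≡ 2ℚ * (2ℚ * gap)
  cauchy-schwarz-gap = trans (cong₂ _-_ (cong₂ _*_ sumOn-Ω sumOn-1/Ω) (cong₂ _*_ sumOn-1 sumOn-1)) (regroup K Σ1/Ω M)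
    where
    regroup : ∀ K T M → 2ℚ * K * (2ℚ * T) - 2ℚ * M * (2ℚ * M) ≡ 2ℚ * (2ℚ * (K * T - M * M))
    regroup = solve-∀ ℚ-ring

  K*[C-qμ]≡gap : K * C - K * (q * μ) ≡ gap
  K*[C-qμ]≡gap = begin
    K * (Σ1/Ω - M) - K * (q * μ)                     ≡⟨ cong (λ t → K * (Σ1/Ω - M) - K * (q * t)) μ≡M-K ⟩
    K * (Σ1/Ω - M) - K * (q * (M - K))               ≡⟨ expand K Σ1/Ω M q ⟩
    K * Σ1/Ω - (q * K) * M - K * M + (q * K) * K     ≡⟨ cong (λ t → K * Σ1/Ω - t * M - K * M + t * K) (/-*-fromℕ (numEdges G) k) ⟩
    K * Σ1/Ω - M * M - K * M + M * K                 ≡⟨ cancel K Σ1/Ω M ⟩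
    gap                                               ∎
    where
    open ≡-Reasoning
    expand : ∀ K T M q → K * (T - M) - K * (q * (M - K)) ≡ K * T - (q * K) * M - K * M + (q * K) * K
    expand = solve-∀ ℚ-ring
    cancel : ∀ K T M → K * T - M * M - K * M + M * K ≡ K * T - M * M
    cancel = solve-∀ ℚ-ring

  gap-nonNeg : 0ℚ ≤ gap
  gap-nonNeg = 0≤2p⇒0≤p (0≤2p⇒0≤p (subst (0ℚ ≤_) cauchy-schwarz-gap (p≤q⇒0≤q-p cauchy-schwarz)))

  lower-bound : q * μ ≤ C
  lower-bound = *-cancelˡ-≤-pos K ⦃ positive (fromℕ-pos (suc k)) ⦄
                  (0≤q-p⇒p≤q (subst (0ℚ ≤_) (sym K*[C-qμ]≡gap) gap-nonNeg))

  gap≡0⇔ : gap ≡ 0ℚ ⇔ Sx * Sy ≡ S1 * S1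
  gap≡0⇔ = mk⇔ (λ gap≡0 → p-q≡0⇒p≡q (trans cauchy-schwarz-gap (cong (λ t → 2ℚ * (2ℚ * t)) gap≡0)))
               (λ eq → 2*-injective (2*-injective (trans (sym cauchy-schwarz-gap) (trans (p≡q⇒p-q≡0 eq) (sym (2*0≡0 2ℚ))))))
    where
    2*0≡0 : ∀ c → 2ℚ * (c * 0ℚ) ≡ 0ℚ
    2*0≡0 = solve-∀ ℚ-ring

  qμ≡C⇔gap≡0 : q * μ ≡ C ⇔ gap ≡ 0ℚ
  qμ≡C⇔gap≡0 = mk⇔ (λ qμ≡C → trans (sym K*[C-qμ]≡gap) (p≡q⇒p-q≡0 (cong (K *_) (sym qμ≡C))))
                   (λ gap≡0 → sym (*-cancelˡ-≡ (pos⇒≢0 (fromℕ-pos (suc k))) (p-q≡0⇒p≡q (trans K*[C-qμ]≡gap gap≡0))))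

  lower-bound-equality : q * μ ≡ C ⇔ ElecEdgeEquiv G Ω
  lower-bound-equality = cauchy-schwarz-equality ⇔-∘ (gap≡0⇔ ⇔-∘ qμ≡C⇔gap≡0)

  h : ℚ
  h = + suc (suc k) / 2

  open EdgeSlack N h (/-*-fromℕ (suc (suc k)) 1)

  sumOn-slack : sumOn (adj G) (λ i j → slack (Ω i j)) ≡ 2ℚ * (h * μ - C)
  sumOn-slack = begin
    sumOn (adj G) (λ i j → slack (Ω i j))
      ≡⟨ sumOn-cong (adj G) (λ i j _ → affine h (Ω i j) (inv (Ω i j))) ⟩
    sumOn (adj G) (λ i j → (- h) * Ω i j + (- 1ℚ) * inv (Ω i j) - (- (h + 1ℚ)))
      ≡⟨ sumOn-affine (adj G) (- h) (- 1ℚ) (- (h + 1ℚ)) Ω (λ i j → inv (Ω i j)) ⟩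
    (- h) * Sx + (- 1ℚ) * Sy - (- (h + 1ℚ)) * S1
      ≡⟨ cong₂ (λ a b → (- h) * a + (- 1ℚ) * b - (- (h + 1ℚ)) * S1) sumOn-Ω sumOn-1/Ω ⟩
    (- h) * (2ℚ * K) + (- 1ℚ) * (2ℚ * Σ1/Ω) - (- (h + 1ℚ)) * S1
      ≡⟨ cong (λ c → (- h) * (2ℚ * K) + (- 1ℚ) * (2ℚ * Σ1/Ω) - (- (h + 1ℚ)) * c) sumOn-1 ⟩
    (- h) * (2ℚ * K) + (- 1ℚ) * (2ℚ * Σ1/Ω) - (- (h + 1ℚ)) * (2ℚ * M)
      ≡⟨ regroup h K Σ1/Ω M ⟩
    2ℚ * (h * (M - K) - (Σ1/Ω - M))
      ≡⟨ cong (λ t → 2ℚ * (h * t - C)) μ≡M-K ⟨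
    2ℚ * (h * μ - C) ∎
    where
    open ≡-Reasoning
    affine : ∀ h x y → h * (1ℚ - x) - (y - 1ℚ) ≡ (- h) * x + (- 1ℚ) * y - (- (h + 1ℚ))
    affine = solve-∀ ℚ-ring
    regroup : ∀ h K T M → (- h) * (2ℚ * K) + (- 1ℚ) * (2ℚ * T) - (- (h + 1ℚ)) * (2ℚ * M) ≡ 2ℚ * (h * (M - K) - (T - M))
    regroup = solve-∀ ℚ-ring

  slack-nonNeg-on-edges : ∀ i j → adj G i j ≡ true → 0ℚ ≤ slack (Ω i j)
  slack-nonNeg-on-edges i j i∼j = slack-nonNeg (Edge.Ω-pos i∼j) (Edge.Ω≤1 i∼j) (Edge.2≤nΩ i∼j)

  upper-bound : C ≤ h * μ
  upper-bound = 0≤q-p⇒p≤q (0≤2p⇒0≤p (subst (0ℚ ≤_) sumOn-slack (sumOn-nonNeg (adj G) slack-nonNeg-on-edges)))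

  C≡hμ⇔slack≡0 : C ≡ h * μ ⇔ (∀ i j → adj G i j ≡ true → slack (Ω i j) ≡ 0ℚ)
  C≡hμ⇔slack≡0 = mk⇔ tight untight
    where
    tight : C ≡ h * μ → ∀ i j → adj G i j ≡ true → slack (Ω i j) ≡ 0ℚ
    tight C≡hμ = nonNeg-sumOn≡0⇒≡0 (adj G) slack-nonNeg-on-edges
      (trans sumOn-slack (trans (cong (2ℚ *_) (p≡q⇒p-q≡0 (sym C≡hμ))) (*-zeroʳ 2ℚ)))
    untight : (∀ i j → adj G i j ≡ true → slack (Ω i j) ≡ 0ℚ) → C ≡ h * μ
    untight slack≡0 = sym (p-q≡0⇒p≡q {h * μ} {C} (2*-injective (begin
      2ℚ * (h * μ - C)                          ≡⟨ sumOn-slack ⟨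
      sumOn (adj G) (λ i j → slack (Ω i j))     ≡⟨ sumOn-cong (adj G) slack≡0 ⟩
      sumOn (adj G) (λ _ _ → 0ℚ)                ≡⟨ sumOn-zero (adj G) ⟩
      0ℚ                                        ≡⟨ *-zeroʳ 2ℚ ⟨
      2ℚ * 0ℚ                                   ∎)))
      where open ≡-Reasoning

  slack≡0⇔dichotomy : (∀ i j → adj G i j ≡ true → slack (Ω i j) ≡ 0ℚ) ⇔
                      (∀ {i j} → adj G i j ≡ true → Ω i j ≡ 1ℚ ⊎ N * Ω i j ≡ 2ℚ)
  slack≡0⇔dichotomy = mk⇔ (λ slack≡0 {i} {j} i∼j → Equivalence.to (slack≡0⇔ (Edge.Ω-pos i∼j)) (slack≡0 i j i∼j))
                          (λ dichotomy i j i∼j → Equivalence.from (slack≡0⇔ (Edge.Ω-pos i∼j)) (dichotomy i∼j))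

  dichotomy⇔tree⊎complete : (∀ {i j} → adj G i j ≡ true → Ω i j ≡ 1ℚ ⊎ N * Ω i j ≡ 2ℚ) ⇔
                            (IsTree G ⊎ IsComplete G)
  dichotomy⇔tree⊎complete = mk⇔ classify classified
    where
    classify : (∀ {i j} → adj G i j ≡ true → Ω i j ≡ 1ℚ ⊎ N * Ω i j ≡ 2ℚ) → IsTree G ⊎ IsComplete G
    classify dichotomy with Finₚ.any? (λ i → Finₚ.any? (λ j → (adj G i j Boolₚ.≟ true) ×-dec ¬? (Ω i j ≟ 1ℚ)))
    ... | yes (i , j , i∼j , Ω≢1) = inj₂ (tight-edge⇒complete dichotomy i∼j Ω≢1)
    ... | no  none                = inj₁ (connected , all-Ω≡1⇒acyclic Ω≡1)
      where
      Ω≡1 : ∀ i j → adj G i j ≡ true → Ω i j ≡ 1ℚ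
      Ω≡1 i j i∼j = decidable-stable (Ω i j ≟ 1ℚ) (λ Ω≢1 → none (i , j , i∼j , Ω≢1))
    classified : IsTree G ⊎ IsComplete G → ∀ {i j} → adj G i j ≡ true → Ω i j ≡ 1ℚ ⊎ N * Ω i j ≡ 2ℚ
    classified (inj₁ (_ , acyclic)) i∼j = inj₁ (Descent.acyclic⇒Ω≡1 i∼j acyclic)
    classified (inj₂ complete)      i∼j = inj₂ (complete⇒nΩ≡2 complete i∼j)

  upper-bound-equality : C ≡ h * μ ⇔ (IsTree G ⊎ IsComplete G)
  upper-bound-equality = dichotomy⇔tree⊎complete ⇔-∘ (slack≡0⇔dichotomy ⇔-∘ C≡hμ⇔slack≡0)

mainTheorem1 : (k : ℕ) (G : Graph (suc (suc k))) (Ω : Fin (suc (suc k)) → Fin (suc (suc k)) → ℚ) →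
    Connected G → IsResistanceDistance G Ω →
    ((+ numEdges G / suc k) * cyclomatic G ≤ cyclicity G Ω)
    × (cyclicity G Ω ≤ (+ suc (suc k) / 2) * cyclomatic G)
    × (((+ numEdges G / suc k) * cyclomatic G ≡ cyclicity G Ω) ⇔ ElecEdgeEquiv G Ω)
    × ((cyclicity G Ω ≡ (+ suc (suc k) / 2) * cyclomatic G) ⇔ (IsTree G ⊎ IsComplete G))
mainTheorem1 k G Ω connected isΩ = lower-bound , upper-bound , lower-bound-equality , upper-bound-equality
  where open Bounds k G Ω connected isΩ
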